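{- Let $p$ be a prime and $n\ge2$, $s\ge1$ integers. For integers $0\le j<s$, \[ E(n\times 2,p^s,p^j)=\varphi_n(p^s)\varphi_{n-1}(p^{s-j})\,p^{s-j}\binom{j+1}{1}_p. \]
   Context: $\mathbb{Z}_{p^s}$ is the ring of integers modulo $p^s$. $E(n\times m,p^s,p^j)$ is the number of $n\times m$ matrices $A$ over $\mathbb{Z}_{p^s}$ such that $Ax\equiv0\pmod{p^s}$ has exactly $p^j$ solutions $x\in\mathbb{Z}_{p^s}^m$. For positive integers $u,c$, $\varphi_u(c)$ is the number of $u$-tuples $(a_1,\dots,a_u)$ with $1\le a_i\le c$ such that at least one $a_i$ is relatively prime to $c$. $\binom{j+1}{1}_p=\frac{1-p^{j+1}}{1-p}=1+p+\dots+p^j$ is a Gaussian binomial coefficient. -}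

module Defs where

open import Data.Nat using (ℕ; zero; suc; _+_; _*_; _^_; _≟_)
open import Data.Fin using (Fin; toℕ)
import Data.Fin
open import Data.Fin.Properties using (any?)
open import Data.List using (List; []; _∷_; map; concatMap; length; filter; allFin)
import Data.Vec.Functional as VF
open import Data.Nat.Coprimality using (Coprime; coprime?)
open import Data.Product using (∃)
open import Relation.Nullary using (Dec)
open import Data.Nat.Divisibility using (_∣_; _∣?_)
open import Relation.Binary.PropositionalEquality using (_≡_)

tuples : {A : Set} (k : ℕ) → List A → List (Fin k → A)
tuples zero    xs = VF.[] ∷ []
tuples (suc k) xs = concatMap (λ a → map (λ v → a VF.∷ v) (tuples k xs)) xs

sumFin : (k : ℕ) → (Fin k → ℕ) → ℕ
sumFin zero    f = 0
sumFin (suc k) f = f Fin.zero + sumFin k (λ i → f (Fin.suc i))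

-- Elements of ℤ_q represented by Fin q (residues 0,…,q-1).
-- An n×m matrix over ℤ_q is a function Fin n → Fin m → Fin q.
Matrix : ℕ → ℕ → ℕ → Set
Matrix n m q = Fin n → Fin m → Fin q

IsSolution : ∀ {n m q} → Matrix n m q → (Fin m → Fin q) → Set
IsSolution {n} {m} {q} A x =
  ∀ (i : Fin n) → q ∣ sumFin m (λ k → toℕ (A i k) * toℕ (x k))

isSolution? : ∀ {n m q} (A : Matrix n m q) (x : Fin m → Fin q) → Dec (IsSolution A x)
isSolution? {n} {m} {q} A x = Data.Fin.Properties.all? (λ i → q ∣? sumFin m (λ k → toℕ (A i k) * toℕ (x k)))
  where import Data.Fin.Properties

numSolutions : ∀ {n m q} → Matrix n m q → ℕ
numSolutions {n} {m} {q} A = length (filter (isSolution? A) (tuples m (allFin q)))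

E : (n m q N : ℕ) → ℕ
E n m q N = length (filter (λ A → numSolutions A ≟ N) (tuples n (tuples m (allFin q))))

-- φ_u(c): number of u-tuples (a_1,…,a_u) with 1 ≤ a_i ≤ c such that some a_i
-- is coprime to c.  The entry i : Fin c represents a = toℕ i + 1.
φ : (u c : ℕ) → ℕ
φ u c = length (filter (λ a → any? (λ i → coprime? (suc (toℕ (a i))) c)) (tuples u (allFin c)))

-- Gaussian binomial (j+1 choose 1)_p = 1 + p + … + p^j
gauss1 : (j p : ℕ) → ℕ
gauss1 zero    p = 1
gauss1 (suc j) p = gauss1 j p + p ^ suc j

-- Write an n × 2 matrix over ℤ/p^s as its pair of columns (u, v), so that Ax = 0 has
-- `kernel u v` solutions.  If u has an entry a prime to p, eliminating x with that row
-- turns the remaining equations into y · w = 0 for a reduced vector w of length n − 1;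
-- for fixed u, v ↦ (t, w) is a bijection, t being the entry of v in the row of a.  The
-- annihilator of w has p^j elements exactly when the entries of w have minimal
-- p-valuation j, which happens for φ_{n−1}(p^{s−j}) vectors w.  When only v has an entry
-- prime to p the same count applies to the w divisible by p, and when both columns are
-- divisible by p, dividing them by p gives the count over ℤ/p^{s−1} for p^{j−2}.  The
-- three terms give a recurrence in j of step 2 whose increments p^{j−1} + p^j add up to
-- the Gaussian binomial 1 + p + ⋯ + p^j.

module Submission where

open import Defs
open import Data.Nat using (ℕ; zero; suc; _+_; _*_; _^_; _∸_; _≤_; _<_; NonZero; >-nonZero⁻¹; nonTrivial⇒n>1; z≤n; s≤s; _%_; _≟_)
open import Data.Nat.Properties
open import Data.Nat.DivMod
open import Data.Nat.Divisibility
open import Data.Nat.Coprimality as Coprimality using (Coprime; coprime?; coprime-Bézout; coprime-divisor)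
import Data.Nat.GCD as GCD
open import Data.Nat.Primality using (Prime; prime⇒irreducible; prime⇒nonZero; prime⇒nonTrivial)
open import Data.Nat.Tactic.RingSolver using (solve-∀)
open import Data.Fin using (Fin; toℕ; fromℕ<)
import Data.Fin.Properties as Finₚ
open import Data.Fin.Permutation using (Permutation; permutation; _⟨$⟩ʳ_)
open import Data.List as List using (List; []; _∷_; allFin)
open import Data.Vec as Vec using (Vec; []; _∷_; insertAt)
open import Data.Vec.Properties using (zipWith-replicate₁)
import Data.Vec.Functional as VF
open import Data.Vec.Relation.Unary.All as All using (All; []; _∷_; all?)
open import Data.Vec.Relation.Unary.Any as Any using (Any; here; there; any?)
import Data.Vec.Relation.Unary.Any.Properties as Anyₚ
open import Data.Product using (∃; ∃₂; _×_; _,_; proj₁; proj₂)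
open import Data.Sum using (_⊎_; inj₁; inj₂)
open import Data.Empty using (⊥-elim)
open import Data.Unit using (⊤; tt)
open import Relation.Nullary using (Dec; yes; no; ¬_; ¬?)
open import Relation.Nullary.Decidable using (_×-dec_)
open import Relation.Binary.Bundles using (Setoid)
open import Relation.Binary.Definitions using (tri<; tri≈; tri>)
open import Relation.Binary.PropositionalEquality
import Relation.Binary.Reasoning.Setoid as SetoidReasoning
open import Function using (_∘_)
import Algebra.Properties.Semiring.Sum as SemiringSum
open import Algebra.Properties.CommutativeSemigroup *-commutativeSemigroup using (x∙yz≈y∙xz; interchange)

-- Indicators and finite sums

𝟙 : {P : Set} → Dec P → ℕ
𝟙 (yes _) = 1
𝟙 (no _)  = 0

𝟙-cong : {P Q : Set} (d : Dec P) (e : Dec Q) → (P → Q) → (Q → P) → 𝟙 d ≡ 𝟙 e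
𝟙-cong (yes _) (yes _) _ _ = refl
𝟙-cong (yes p) (no ¬q) f _ = ⊥-elim (¬q (f p))
𝟙-cong (no ¬p) (yes q) _ g = ⊥-elim (¬p (g q))
𝟙-cong (no _)  (no _)  _ _ = refl

𝟙-true : {P : Set} (d : Dec P) → P → 𝟙 d ≡ 1
𝟙-true (yes _) _ = refl
𝟙-true (no ¬p) p = ⊥-elim (¬p p)

𝟙-false : {P : Set} (d : Dec P) → ¬ P → 𝟙 d ≡ 0
𝟙-false (yes p) ¬p = ⊥-elim (¬p p)
𝟙-false (no _)  _  = refl

𝟙-× : {R P Q : Set} (r : Dec R) (d : Dec P) (e : Dec Q) →
  (R → P × Q) → (P → Q → R) → 𝟙 r ≡ 𝟙 d * 𝟙 e
𝟙-× (yes r) d e f g = sym (cong₂ _*_ (𝟙-true d (proj₁ (f r))) (𝟙-true e (proj₂ (f r))))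
𝟙-× (no ¬x) (yes p) (yes q) f g = ⊥-elim (¬x (g p q))
𝟙-× (no _)  (yes _) (no _)  f g = refl
𝟙-× (no _)  (no _)  e       f g = refl

𝟙-complement : {P Q : Set} (d : Dec P) (e : Dec Q) → (P → ¬ Q) → (¬ Q → P) → 𝟙 d + 𝟙 e ≡ 1
𝟙-complement (yes p) (yes q) f _ = ⊥-elim (f p q)
𝟙-complement (yes _) (no _)  _ _ = refl
𝟙-complement (no _)  (yes _) _ _ = refl
𝟙-complement (no ¬p) (no ¬q) _ g = ⊥-elim (¬p (g ¬q))

𝟙-⊎ : {R P Q : Set} (r : Dec R) (d : Dec P) (e : Dec Q) →
  (R → P ⊎ Q) → (P → R) → (Q → R) → (P → ¬ Q) → 𝟙 r ≡ 𝟙 d + 𝟙 e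
𝟙-⊎ (yes _) (yes p) (yes q) _ _ _ p⇒¬q = ⊥-elim (p⇒¬q p q)
𝟙-⊎ (yes _) (yes _) (no _)  _ _ _ _    = refl
𝟙-⊎ (yes _) (no _)  (yes _) _ _ _ _    = refl
𝟙-⊎ (yes r) (no ¬p) (no ¬q) f _ _ _ with f r
... | inj₁ p = ⊥-elim (¬p p)
... | inj₂ q = ⊥-elim (¬q q)
𝟙-⊎ (no ¬r) (yes p) _       _ g _ _    = ⊥-elim (¬r (g p))
𝟙-⊎ (no ¬r) (no _)  (yes q) _ _ h _    = ⊥-elim (¬r (h q))
𝟙-⊎ (no _)  (no _)  (no _)  _ _ _ _    = refl

sumList : {A : Set} → List A → (A → ℕ) → ℕ
sumList []       f = 0
sumList (x ∷ xs) f = f x + sumList xs f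

length-filter : {A : Set} {P : A → Set} (P? : ∀ x → Dec (P x)) (xs : List A) →
  List.length (List.filter P? xs) ≡ sumList xs (𝟙 ∘ P?)
length-filter P? [] = refl
length-filter P? (x ∷ xs) with P? x
... | yes _ = cong suc (length-filter P? xs)
... | no _  = length-filter P? xs

sumList-cong : {A : Set} (xs : List A) {f g : A → ℕ} → (∀ x → f x ≡ g x) → sumList xs f ≡ sumList xs g
sumList-cong []       e = refl
sumList-cong (x ∷ xs) e = cong₂ _+_ (e x) (sumList-cong xs e)

sumList-++ : {A : Set} (xs ys : List A) (f : A → ℕ) → sumList (xs List.++ ys) f ≡ sumList xs f + sumList ys f
sumList-++ []       ys f = refl
sumList-++ (x ∷ xs) ys f = trans (cong (f x +_) (sumList-++ xs ys f)) (sym (+-assoc (f x) _ _))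

sumList-map : {A B : Set} (h : A → B) (xs : List A) (f : B → ℕ) → sumList (List.map h xs) f ≡ sumList xs (f ∘ h)
sumList-map h []       f = refl
sumList-map h (x ∷ xs) f = cong (f (h x) +_) (sumList-map h xs f)

sumList-concatMap : {A B : Set} (h : A → List B) (xs : List A) (f : B → ℕ) →
  sumList (List.concatMap h xs) f ≡ sumList xs (λ a → sumList (h a) f)
sumList-concatMap h []       f = refl
sumList-concatMap h (x ∷ xs) f =
  trans (sumList-++ (h x) (List.concatMap h xs) f) (cong (sumList (h x) f +_) (sumList-concatMap h xs f))

sumList-tabulate : ∀ {n} {B : Set} (g : Fin n → B) (f : B → ℕ) →
  sumList (List.tabulate g) f ≡ sumList (allFin n) (f ∘ g)
sumList-tabulate {zero}  g f = refl
sumList-tabulate {suc n} g f =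
  cong (f (g Fin.zero) +_) (trans (sumList-tabulate (g ∘ Fin.suc) f) (sym (sumList-tabulate Fin.suc (f ∘ g))))

module ∑ = SemiringSum +-*-semiring

sum< : ℕ → (ℕ → ℕ) → ℕ
sum< zero    f = 0
sum< (suc q) f = f 0 + sum< q (f ∘ suc)

sum<≡∑ : ∀ q (f : ℕ → ℕ) → sum< q f ≡ ∑.sum {q} (f ∘ toℕ)
sum<≡∑ zero    f = refl
sum<≡∑ (suc q) f = cong (f 0 +_) (sum<≡∑ q (f ∘ suc))

sumList-allFin : ∀ q (f : ℕ → ℕ) → sumList (allFin q) (f ∘ toℕ) ≡ sum< q f
sumList-allFin zero    f = refl
sumList-allFin (suc q) f =
  cong (f 0 +_) (trans (sumList-tabulate {q} Fin.suc (f ∘ toℕ)) (sumList-allFin q (f ∘ suc)))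

sum<-cong-< : ∀ q {f g : ℕ → ℕ} → (∀ x → x < q → f x ≡ g x) → sum< q f ≡ sum< q g
sum<-cong-< zero    e = refl
sum<-cong-< (suc q) e = cong₂ _+_ (e 0 (s≤s z≤n)) (sum<-cong-< q (λ x x<q → e (suc x) (s≤s x<q)))

sum<-cong : ∀ q {f g : ℕ → ℕ} → (∀ x → f x ≡ g x) → sum< q f ≡ sum< q g
sum<-cong q e = sum<-cong-< q (λ x _ → e x)

sum<-+ : ∀ q (f g : ℕ → ℕ) → sum< q (λ x → f x + g x) ≡ sum< q f + sum< q g
sum<-+ q f g = trans (sum<≡∑ q _)
  (trans (∑.∑-distrib-+ {q} (f ∘ toℕ) (g ∘ toℕ)) (sym (cong₂ _+_ (sum<≡∑ q f) (sum<≡∑ q g))))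

sum<-*ˡ : ∀ q c (f : ℕ → ℕ) → sum< q (λ x → c * f x) ≡ c * sum< q f
sum<-*ˡ zero    c f = sym (*-zeroʳ c)
sum<-*ˡ (suc q) c f = trans (cong (c * f 0 +_) (sum<-*ˡ q c (f ∘ suc))) (sym (*-distribˡ-+ c (f 0) _))

sum<-*ʳ : ∀ q c (f : ℕ → ℕ) → sum< q (λ x → f x * c) ≡ sum< q f * c
sum<-*ʳ q c f = trans (sum<-cong q (λ x → *-comm (f x) c)) (trans (sum<-*ˡ q c f) (*-comm c _))

sum<-zero : ∀ q → sum< q (λ _ → 0) ≡ 0
sum<-zero zero    = refl
sum<-zero (suc q) = sum<-zero q

sum<-const : ∀ q c → sum< q (λ _ → c) ≡ q * c
sum<-const zero    c = refl
sum<-const (suc q) c = cong (c +_) (sum<-const q c)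

sum<-comm : ∀ m n (f : ℕ → ℕ → ℕ) → sum< m (λ x → sum< n (f x)) ≡ sum< n (λ y → sum< m (λ x → f x y))
sum<-comm m n f = begin
  sum< m (λ x → sum< n (f x))                  ≡⟨ trans (sum<-cong m (λ x → sum<≡∑ n (f x))) (sum<≡∑ m _) ⟩
  ∑.sum {m} (λ i → ∑.sum {n} (λ j → f (toℕ i) (toℕ j))) ≡⟨ ∑.∑-comm {m} {n} (λ i j → f (toℕ i) (toℕ j)) ⟩
  ∑.sum {n} (λ j → ∑.sum {m} (λ i → f (toℕ i) (toℕ j))) ≡⟨ sym (trans (sum<-cong n (λ y → sum<≡∑ m (λ x → f x y))) (sum<≡∑ n _)) ⟩
  sum< n (λ y → sum< m (λ x → f x y))          ∎
  where open ≡-Reasoning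

sum<-+-split : ∀ m k (f : ℕ → ℕ) → sum< (m + k) f ≡ sum< m f + sum< k (λ x → f (m + x))
sum<-+-split zero    k f = refl
sum<-+-split (suc m) k f = trans (cong (f 0 +_) (sum<-+-split m k (f ∘ suc))) (sym (+-assoc (f 0) _ _))

sum<-bijection : ∀ q (σ τ : ℕ → ℕ) → (∀ x → x < q → σ x < q) → (∀ x → x < q → τ x < q) →
  (∀ x → x < q → τ (σ x) ≡ x) → (∀ x → x < q → σ (τ x) ≡ x) →
  (f : ℕ → ℕ) → sum< q (f ∘ σ) ≡ sum< q f
sum<-bijection q σ τ σ< τ< τσ στ f = begin
  sum< q (f ∘ σ)                       ≡⟨ sum<≡∑ q (f ∘ σ) ⟩
  ∑.sum {q} (f ∘ σ ∘ toℕ)               ≡⟨ ∑.sum-cong-≗ (λ i → cong f (sym (Finₚ.toℕ-fromℕ< (σ< (toℕ i) (Finₚ.toℕ<n i))))) ⟩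
  ∑.sum {q} (f ∘ toℕ ∘ (π ⟨$⟩ʳ_))      ≡⟨ sym (∑.sum-permute (f ∘ toℕ) π) ⟩
  ∑.sum {q} (f ∘ toℕ)                 ≡⟨ sym (sum<≡∑ q f) ⟩
  sum< q f                             ∎
  where
  open ≡-Reasoning
  onFin : (h : ℕ → ℕ) → (∀ x → x < q → h x < q) → Fin q → Fin q
  onFin h h< i = fromℕ< (h< (toℕ i) (Finₚ.toℕ<n i))
  inverse : ∀ {g h} g< h< → (∀ x → x < q → g (h x) ≡ x) → ∀ i → onFin g g< (onFin h h< i) ≡ i
  inverse {g} {h} _ _ gh i = Finₚ.toℕ-injective
    (trans (Finₚ.toℕ-fromℕ< _) (trans (cong g (Finₚ.toℕ-fromℕ< _)) (gh (toℕ i) (Finₚ.toℕ<n i))))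
  π : Permutation q q
  π = permutation (onFin σ σ<) (onFin τ τ<) (inverse σ< τ< στ) (inverse τ< σ< τσ)

sumVec : (m q : ℕ) → (Vec ℕ m → ℕ) → ℕ
sumVec zero    q G = G []
sumVec (suc m) q G = sum< q (λ a → sumVec m q (λ w → G (a ∷ w)))

sumVec-cong : ∀ m q {G H : Vec ℕ m → ℕ} → (∀ w → G w ≡ H w) → sumVec m q G ≡ sumVec m q H
sumVec-cong zero    q e = e []
sumVec-cong (suc m) q e = sum<-cong q (λ a → sumVec-cong m q (λ w → e (a ∷ w)))

sumVec-+ : ∀ m q (G H : Vec ℕ m → ℕ) → sumVec m q (λ w → G w + H w) ≡ sumVec m q G + sumVec m q H
sumVec-+ zero    q G H = refl
sumVec-+ (suc m) q G H = trans (sum<-cong q (λ a → sumVec-+ m q _ _)) (sum<-+ q _ _)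

sumVec-*ˡ : ∀ m q c (G : Vec ℕ m → ℕ) → sumVec m q (λ w → c * G w) ≡ c * sumVec m q G
sumVec-*ˡ zero    q c G = refl
sumVec-*ˡ (suc m) q c G = trans (sum<-cong q (λ a → sumVec-*ˡ m q c _)) (sum<-*ˡ q c _)

sumVec-zero : ∀ m q → sumVec m q (λ _ → 0) ≡ 0
sumVec-zero zero    q = refl
sumVec-zero (suc m) q = trans (sum<-cong q (λ _ → sumVec-zero m q)) (sum<-zero q)

sumVec-one : ∀ m q → sumVec m q (λ _ → 1) ≡ q ^ m
sumVec-one zero    q = refl
sumVec-one (suc m) q = trans (sum<-cong q (λ _ → sumVec-one m q)) (sum<-const q (q ^ m))

sumVec-sum< : ∀ m q n (G : Vec ℕ m → ℕ → ℕ) →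
  sumVec m q (λ w → sum< n (G w)) ≡ sum< n (λ x → sumVec m q (λ w → G w x))
sumVec-sum< zero    q n G = refl
sumVec-sum< (suc m) q n G = trans (sum<-cong q (λ a → sumVec-sum< m q n _)) (sum<-comm q n _)

sumVec-comm : ∀ m k q (G : Vec ℕ m → Vec ℕ k → ℕ) →
  sumVec m q (λ u → sumVec k q (G u)) ≡ sumVec k q (λ v → sumVec m q (λ u → G u v))
sumVec-comm zero    k q G = refl
sumVec-comm (suc m) k q G = trans (sum<-cong q (λ a → sumVec-comm m k q _)) (sym (sumVec-sum< k q q _))

sumVec-insertAt : ∀ m q (i : Fin (suc m)) (G : Vec ℕ (suc m) → ℕ) →
  sumVec (suc m) q G ≡ sum< q (λ t → sumVec m q (λ v → G (insertAt v i t)))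
sumVec-insertAt m       q Fin.zero    G = refl
sumVec-insertAt (suc m) q (Fin.suc i) G =
  trans (sum<-cong q (λ a → sumVec-insertAt m q i (λ w → G (a ∷ w)))) (sum<-comm q q _)

sumVec-bijection : ∀ m q (f g : ℕ → ℕ → ℕ) →
  (∀ c x → x < q → f c x < q) → (∀ c x → x < q → g c x < q) →
  (∀ c x → x < q → g c (f c x) ≡ x) → (∀ c x → x < q → f c (g c x) ≡ x) →
  (cs : Vec ℕ m) (G : Vec ℕ m → ℕ) → sumVec m q (λ w → G (Vec.zipWith f cs w)) ≡ sumVec m q G
sumVec-bijection zero    q f g f< g< gf fg []       G = refl
sumVec-bijection (suc m) q f g f< g< gf fg (c ∷ cs) G =
  trans (sum<-cong q (λ a → sumVec-bijection m q f g f< g< gf fg cs (λ w → G (f c a ∷ w))))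
        (sum<-bijection q (f c) (g c) (f< c) (g< c) (gf c) (fg c) (λ b → sumVec m q (λ w → G (b ∷ w))))

sumVec-map-bijection : ∀ m q (f g : ℕ → ℕ) → (∀ x → x < q → f x < q) → (∀ x → x < q → g x < q) →
  (∀ x → x < q → g (f x) ≡ x) → (∀ x → x < q → f (g x) ≡ x) →
  (G : Vec ℕ m → ℕ) → sumVec m q (G ∘ Vec.map f) ≡ sumVec m q G
sumVec-map-bijection m q f g f< g< gf fg G =
  trans (sumVec-cong m q (λ w → cong G (sym (zipWith-replicate₁ (λ _ → f) 0 w))))
        (sumVec-bijection m q (λ _ → f) (λ _ → g) (λ _ → f<) (λ _ → g<) (λ _ → gf) (λ _ → fg) (Vec.replicate m 0) G)

𝟙-all-∷ : {P : ℕ → Set} (P? : ∀ x → Dec (P x)) (x : ℕ) {m : ℕ} (xs : Vec ℕ m) →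
  𝟙 (all? P? (x ∷ xs)) ≡ 𝟙 (P? x) * 𝟙 (all? P? xs)
𝟙-all-∷ P? x xs = 𝟙-× (all? P? (x ∷ xs)) (P? x) (all? P? xs) (λ { (p ∷ ps) → p , ps }) _∷_

sumVec-all : ∀ m q {P : ℕ → Set} (P? : ∀ x → Dec (P x)) →
  sumVec m q (λ w → 𝟙 (all? P? w)) ≡ sum< q (𝟙 ∘ P?) ^ m
sumVec-all zero    q P? = refl
sumVec-all (suc m) q P? = begin
  sum< q (λ a → sumVec m q (λ w → 𝟙 (all? P? (a ∷ w))))
    ≡⟨ sum<-cong q (λ a → trans (sumVec-cong m q (𝟙-all-∷ P? a)) (sumVec-*ˡ m q (𝟙 (P? a)) _)) ⟩
  sum< q (λ a → 𝟙 (P? a) * sumVec m q (λ w → 𝟙 (all? P? w)))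
    ≡⟨ sum<-*ʳ q _ _ ⟩
  sum< q (𝟙 ∘ P?) * sumVec m q (λ w → 𝟙 (all? P? w))
    ≡⟨ cong (sum< q (𝟙 ∘ P?) *_) (sumVec-all m q P?) ⟩
  sum< q (𝟙 ∘ P?) ^ suc m ∎
  where open ≡-Reasoning

sumVec-complement : ∀ m q {P Q : Vec ℕ m → Set} (P? : ∀ w → Dec (P w)) (Q? : ∀ w → Dec (Q w)) →
  (∀ w → P w → ¬ Q w) → (∀ w → ¬ Q w → P w) → (G : Vec ℕ m → ℕ) →
  sumVec m q G ≡ sumVec m q (λ w → 𝟙 (P? w) * G w) + sumVec m q (λ w → 𝟙 (Q? w) * G w)
sumVec-complement m q P? Q? f g G = trans (sumVec-cong m q split) (sumVec-+ m q _ _)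
  where
  split : ∀ w → G w ≡ 𝟙 (P? w) * G w + 𝟙 (Q? w) * G w
  split w = begin
    G w                               ≡⟨ sym (*-identityˡ (G w)) ⟩
    1 * G w                           ≡⟨ cong (_* G w) (sym (𝟙-complement (P? w) (Q? w) (f w) (g w))) ⟩
    (𝟙 (P? w) + 𝟙 (Q? w)) * G w       ≡⟨ *-distribʳ-+ (G w) (𝟙 (P? w)) (𝟙 (Q? w)) ⟩
    𝟙 (P? w) * G w + 𝟙 (Q? w) * G w   ∎
    where open ≡-Reasoning

sumVec-𝟙-*-const : ∀ k q {P : Vec ℕ k → Set} (P? : ∀ w → Dec (P w)) (H : Vec ℕ k → ℕ) c →
  (∀ w → P w → H w ≡ c) → sumVec k q (λ w → 𝟙 (P? w) * H w) ≡ sumVec k q (𝟙 ∘ P?) * c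
sumVec-𝟙-*-const k q P? H c H≡c = trans (sumVec-cong k q on-P) (trans (sumVec-*ˡ k q c _) (*-comm c _))
  where
  on-P : ∀ w → 𝟙 (P? w) * H w ≡ c * 𝟙 (P? w)
  on-P w with P? w
  ... | yes pw = trans (+-identityʳ (H w)) (trans (H≡c w pw) (sym (*-identityʳ c)))
  ... | no _   = sym (*-zeroʳ c)

sumVec-*-comm : ∀ k q (f g : Vec ℕ k → ℕ) (H : Vec ℕ k → Vec ℕ k → ℕ) →
  sumVec k q (λ u → f u * sumVec k q (λ v → g v * H u v)) ≡ sumVec k q (λ v → g v * sumVec k q (λ u → f u * H u v))
sumVec-*-comm k q f g H = begin
  sumVec k q (λ u → f u * sumVec k q (λ v → g v * H u v))   ≡⟨ sumVec-cong k q (λ u → sym (sumVec-*ˡ k q (f u) _)) ⟩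
  sumVec k q (λ u → sumVec k q (λ v → f u * (g v * H u v)))  ≡⟨ sumVec-comm k k q _ ⟩
  sumVec k q (λ v → sumVec k q (λ u → f u * (g v * H u v)))  ≡⟨ sumVec-cong k q (λ v → trans (sumVec-cong k q (λ u → x∙yz≈y∙xz (f u) (g v) (H u v))) (sumVec-*ˡ k q (g v) _)) ⟩
  sumVec k q (λ v → g v * sumVec k q (λ u → f u * H u v))   ∎
  where open ≡-Reasoning

¬All⇒Any¬ : ∀ {m} {P : ℕ → Set} (P? : ∀ x → Dec (P x)) (w : Vec ℕ m) → ¬ All P w → Any (¬_ ∘ P) w
¬All⇒Any¬ P? []      ¬all = ⊥-elim (¬all [])
¬All⇒Any¬ P? (z ∷ w) ¬all with P? z
... | yes pz = there (¬All⇒Any¬ P? w (¬all ∘ (pz ∷_)))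
... | no ¬pz = here ¬pz

Any¬⇒¬All : ∀ {m} {P : ℕ → Set} {w : Vec ℕ m} → Any (¬_ ∘ P) w → ¬ All P w
Any¬⇒¬All (here ¬pz) (pz ∷ _)  = ¬pz pz
Any¬⇒¬All (there ¬p) (_ ∷ all) = Any¬⇒¬All ¬p all

All-insertAt⁻ : ∀ {m} {P : ℕ → Set} (i : Fin (suc m)) t (v : Vec ℕ m) → All P (insertAt v i t) → P t × All P v
All-insertAt⁻ Fin.zero t v (pt ∷ pv) = pt , pv
All-insertAt⁻ {suc m} (Fin.suc i) t (x ∷ v) (px ∷ pv) with All-insertAt⁻ i t v pv
... | pt , pv′ = pt , px ∷ pv′

All-insertAt⁺ : ∀ {m} {P : ℕ → Set} (i : Fin (suc m)) t (v : Vec ℕ m) → P t → All P v → All P (insertAt v i t)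
All-insertAt⁺ Fin.zero t v pt pv = pt ∷ pv
All-insertAt⁺ {suc m} (Fin.suc i) t (x ∷ v) pt (px ∷ pv) = px ∷ All-insertAt⁺ i t v pt pv

𝟙-all-insertAt : ∀ {m} {P : ℕ → Set} (P? : ∀ x → Dec (P x)) (i : Fin (suc m)) t (v : Vec ℕ m) →
  𝟙 (all? P? (insertAt v i t)) ≡ 𝟙 (P? t) * 𝟙 (all? P? v)
𝟙-all-insertAt P? i t v = 𝟙-× (all? P? (insertAt v i t)) (P? t) (all? P? v) (All-insertAt⁻ i t v) (All-insertAt⁺ i t v)

Any⇒insertAt : ∀ {m} {P : ℕ → Set} (u : Vec ℕ (suc m)) → Any P u →
  ∃ λ i → ∃ λ a → ∃ λ u′ → u ≡ insertAt u′ i a × P a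
Any⇒insertAt (x ∷ u) (here px) = Fin.zero , x , u , refl , px
Any⇒insertAt {suc m} (x ∷ u) (there pu) with Any⇒insertAt u pu
... | i , a , u′ , refl , pa = Fin.suc i , a , x ∷ u′ , refl , pa

sum<-𝟙-≡ : ∀ q x₀ → x₀ < q → sum< q (λ x → 𝟙 (x ≟ x₀)) ≡ 1
sum<-𝟙-≡ (suc q) zero     _ = cong suc (trans (sum<-cong q (λ x → 𝟙-false (suc x ≟ 0) λ ())) (sum<-zero q))
sum<-𝟙-≡ (suc q) (suc x₀) (s≤s x₀<q) =
  trans (sum<-cong q (λ x → 𝟙-cong (suc x ≟ suc x₀) (x ≟ x₀) suc-injective (cong suc))) (sum<-𝟙-≡ q x₀ x₀<q)

sum<-𝟙-unique : ∀ q {P : ℕ → Set} (P? : ∀ x → Dec (P x)) x₀ → x₀ < q → P x₀ →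
  (∀ x → x < q → P x → x ≡ x₀) → sum< q (𝟙 ∘ P?) ≡ 1
sum<-𝟙-unique q P? x₀ x₀<q px₀ unique =
  trans (sum<-cong-< q (λ x x<q → 𝟙-cong (P? x) (x ≟ x₀) (unique x x<q) (λ { refl → px₀ }))) (sum<-𝟙-≡ q x₀ x₀<q)

sum<-multiples : ∀ c d .{{_ : NonZero d}} (f : ℕ → ℕ) →
  sum< (c * d) (λ x → 𝟙 (d ∣? x) * f x) ≡ sum< c (f ∘ (d *_))
sum<-multiples zero    d f = refl
sum<-multiples (suc c) d@(suc d′) f = begin
  sum< (d + c * d) (λ x → 𝟙 (d ∣? x) * f x)
    ≡⟨ sum<-+-split d (c * d) (λ x → 𝟙 (d ∣? x) * f x) ⟩
  sum< d (λ x → 𝟙 (d ∣? x) * f x) + sum< (c * d) (λ x → 𝟙 (d ∣? (d + x)) * f (d + x))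
    ≡⟨ cong₂ _+_ first (sum<-cong (c * d) (λ x → cong (_* f (d + x)) (𝟙-cong (d ∣? (d + x)) (d ∣? x) (λ h → ∣m+n∣m⇒∣n h ∣-refl) (∣m∣n⇒∣m+n ∣-refl)))) ⟩
  f (d * 0) + sum< (c * d) (λ x → 𝟙 (d ∣? x) * f (d + x))
    ≡⟨ cong (f (d * 0) +_) (sum<-multiples c d (f ∘ (d +_))) ⟩
  f (d * 0) + sum< c (λ x → f (d + d * x))
    ≡⟨ cong (f (d * 0) +_) (sum<-cong c (λ x → cong f (sym (*-suc d x)))) ⟩
  sum< (suc c) (f ∘ (d *_)) ∎
  where
  open ≡-Reasoning
  first : sum< d (λ x → 𝟙 (d ∣? x) * f x) ≡ f (d * 0)
  first = begin
    𝟙 (d ∣? 0) * f 0 + sum< d′ (λ x → 𝟙 (d ∣? suc x) * f (suc x))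
      ≡⟨ cong₂ _+_ (cong (_* f 0) (𝟙-true (d ∣? 0) (d ∣0)))
                   (sum<-cong-< d′ (λ x x<d′ → cong (_* f (suc x)) (𝟙-false (d ∣? suc x) (λ h → <⇒≱ (s≤s x<d′) (∣⇒≤ h))))) ⟩
    1 * f 0 + sum< d′ (λ _ → 0)  ≡⟨ cong₂ _+_ (*-identityˡ (f 0)) (sum<-zero d′) ⟩
    f 0 + 0                      ≡⟨ trans (+-identityʳ (f 0)) (cong f (sym (*-zeroʳ d))) ⟩
    f (d * 0)                    ∎

count-multiples : ∀ c d .{{_ : NonZero d}} → sum< (c * d) (𝟙 ∘ (d ∣?_)) ≡ c
count-multiples c d = begin
  sum< (c * d) (𝟙 ∘ (d ∣?_))                   ≡⟨ sum<-cong (c * d) (λ x → sym (*-identityʳ (𝟙 (d ∣? x)))) ⟩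
  sum< (c * d) (λ x → 𝟙 (d ∣? x) * 1)          ≡⟨ sum<-multiples c d (λ _ → 1) ⟩
  sum< c (λ _ → 1)                             ≡⟨ trans (sum<-const c 1) (*-identityʳ c) ⟩
  c                                            ∎
  where open ≡-Reasoning

sumVec-multiples : ∀ k c d .{{_ : NonZero d}} (H : Vec ℕ k → ℕ) →
  sumVec k (c * d) (λ u → 𝟙 (all? (d ∣?_) u) * H u) ≡ sumVec k c (H ∘ Vec.map (d *_))
sumVec-multiples zero    c d H = *-identityˡ (H [])
sumVec-multiples (suc k) c d H = begin
  sum< (c * d) (λ a → sumVec k (c * d) (λ w → 𝟙 (all? (d ∣?_) (a ∷ w)) * H (a ∷ w)))
    ≡⟨ sum<-cong (c * d) (λ a → trans (sumVec-cong k (c * d) (λ w → trans (cong (_* H (a ∷ w)) (𝟙-all-∷ (d ∣?_) a w)) (*-assoc (𝟙 (d ∣? a)) _ _)))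
                                      (sumVec-*ˡ k (c * d) (𝟙 (d ∣? a)) _)) ⟩
  sum< (c * d) (λ a → 𝟙 (d ∣? a) * sumVec k (c * d) (λ w → 𝟙 (all? (d ∣?_) w) * H (a ∷ w)))
    ≡⟨ sum<-multiples c d _ ⟩
  sum< c (λ a → sumVec k (c * d) (λ w → 𝟙 (all? (d ∣?_) w) * H (d * a ∷ w)))
    ≡⟨ sum<-cong c (λ a → sumVec-multiples k c d (λ w → H (d * a ∷ w))) ⟩
  sumVec (suc k) c (H ∘ Vec.map (d *_)) ∎
  where open ≡-Reasoning

sum<-% : ∀ c d .{{_ : NonZero d}} (f : ℕ → ℕ) → sum< (c * d) (f ∘ (_% d)) ≡ c * sum< d f
sum<-% zero    d f = refl
sum<-% (suc c) d f = begin
  sum< (d + c * d) (f ∘ (_% d))                              ≡⟨ sum<-+-split d (c * d) (f ∘ (_% d)) ⟩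
  sum< d (f ∘ (_% d)) + sum< (c * d) (λ x → f ((d + x) % d))
    ≡⟨ cong₂ _+_ (sum<-cong-< d (λ x x<d → cong f (m<n⇒m%n≡m x<d)))
                 (sum<-cong (c * d) (λ x → cong f (trans (cong (_% d) (+-comm d x)) ([m+n]%n≡m%n x d)))) ⟩
  sum< d f + sum< (c * d) (f ∘ (_% d))                       ≡⟨ cong (sum< d f +_) (sum<-% c d f) ⟩
  sum< d f + c * sum< d f                                    ∎
  where open ≡-Reasoning

-- Elementary number theory

^-distribʳ-* : ∀ a b k → (a * b) ^ k ≡ a ^ k * b ^ k
^-distribʳ-* a b zero    = refl
^-distribʳ-* a b (suc k) = trans (cong (a * b *_) (^-distribʳ-* a b k)) (interchange a b (a ^ k) (b ^ k))

∤⇒coprime : ∀ {p a} → Prime p → ¬ p ∣ a → Coprime a p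
∤⇒coprime pp p∤a {d} (d∣a , d∣p) with prime⇒irreducible pp d∣p
... | inj₁ d≡1 = d≡1
... | inj₂ refl = ⊥-elim (p∤a d∣a)

coprime-* : ∀ {a m n} → Coprime a m → Coprime a n → Coprime a (m * n)
coprime-* cm cn (d∣a , d∣mn) =
  cn (d∣a , coprime-divisor (λ (e∣d , e∣m) → cm (∣-trans e∣d d∣a , e∣m)) d∣mn)

coprime-^ : ∀ {a p} → Coprime a p → ∀ s → Coprime a (p ^ s)
coprime-^ c zero    (_ , d∣1) = ∣1⇒≡1 d∣1
coprime-^ c (suc s) = coprime-* c (coprime-^ c s)

module Congruence (q : ℕ) .{{_ : NonZero q}} where

  infix 4 _≈_
  _≈_ : ℕ → ℕ → Set
  x ≈ y = x % q ≡ y % q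

  ≈-setoid : Setoid _ _
  ≈-setoid = record { Carrier = ℕ ; _≈_ = _≈_ ; isEquivalence = record { refl = refl ; sym = sym ; trans = trans } }

  module ≈-Reasoning = SetoidReasoning ≈-setoid

  -- q ∸ 1 plays the role of −1.
  Q : ℕ
  Q = q ∸ 1

  suc-Q : suc Q ≡ q
  suc-Q = suc-pred q

  ≡⇒≈ : ∀ {x y} → x ≡ y → x ≈ y
  ≡⇒≈ = cong (_% q)

  ≈-+ : ∀ {a a′ b b′} → a ≈ a′ → b ≈ b′ → a + b ≈ a′ + b′
  ≈-+ {a} {a′} {b} {b′} e f =
    trans (%-distribˡ-+ a b q) (trans (cong₂ (λ x y → (x + y) % q) e f) (sym (%-distribˡ-+ a′ b′ q)))

  ≈-* : ∀ {a a′ b b′} → a ≈ a′ → b ≈ b′ → a * b ≈ a′ * b′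
  ≈-* {a} {a′} {b} {b′} e f =
    trans (%-distribˡ-* a b q) (trans (cong₂ (λ x y → (x * y) % q) e f) (sym (%-distribˡ-* a′ b′ q)))

  ≈-+ˡ : ∀ c {b b′} → b ≈ b′ → c + b ≈ c + b′
  ≈-+ˡ c = ≈-+ {c} refl

  ≈-+ʳ : ∀ c {b b′} → b ≈ b′ → b + c ≈ b′ + c
  ≈-+ʳ c e = ≈-+ e (refl {x = c % q})

  ≈-*ˡ : ∀ c {b b′} → b ≈ b′ → c * b ≈ c * b′
  ≈-*ˡ c = ≈-* {c} refl

  ≈-*ʳ : ∀ c {b b′} → b ≈ b′ → b * c ≈ b′ * c
  ≈-*ʳ c e = ≈-* e (refl {x = c % q})

  %-≈ : ∀ x → x % q ≈ x
  %-≈ x = m%n%n≡m%n x q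

  0%q : 0 % q ≡ 0
  0%q = m<n⇒m%n≡m (>-nonZero⁻¹ q)

  ∣⇒≈0 : ∀ {x} → q ∣ x → x ≈ 0
  ∣⇒≈0 {x} d = trans (n∣m⇒m%n≡0 x q d) (sym 0%q)

  ≈0⇒∣ : ∀ {x} → x ≈ 0 → q ∣ x
  ≈0⇒∣ {x} e = m%n≡0⇒n∣m x q (trans e 0%q)

  q*≈0 : ∀ x → q * x ≈ 0
  q*≈0 x = ∣⇒≈0 (m∣m*n x)

  +-inverse : ∀ x → x + Q * x ≈ 0
  +-inverse x = trans (≡⇒≈ (cong (_* x) suc-Q)) (q*≈0 x)

  +-cancelʳ-≈ : ∀ {a a′} b → a + b ≈ a′ + b → a ≈ a′
  +-cancelʳ-≈ {a} {a′} b e = begin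
    a                 ≡⟨ sym (+-identityʳ a) ⟩
    a + 0             ≈⟨ ≈-+ˡ a (sym (+-inverse b)) ⟩
    a + (b + Q * b)   ≡⟨ sym (+-assoc a b (Q * b)) ⟩
    a + b + Q * b     ≈⟨ ≈-+ʳ (Q * b) e ⟩
    a′ + b + Q * b    ≡⟨ +-assoc a′ b (Q * b) ⟩
    a′ + (b + Q * b)  ≈⟨ ≈-+ˡ a′ (+-inverse b) ⟩
    a′ + 0            ≡⟨ +-identityʳ a′ ⟩
    a′                ∎
    where open ≈-Reasoning

  ≈⇒≡ : ∀ {x y} → x < q → y < q → x ≈ y → x ≡ y
  ≈⇒≡ x<q y<q e = trans (sym (m<n⇒m%n≡m x<q)) (trans e (m<n⇒m%n≡m y<q))

  ≈⇒%≡ : ∀ {x y} → y < q → x ≈ y → x % q ≡ y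
  ≈⇒%≡ y<q e = trans e (m<n⇒m%n≡m y<q)

  *-cancelˡ-≈ : ∀ {i a x y} → i * a ≈ 1 → a * x ≈ a * y → x ≈ y
  *-cancelˡ-≈ {i} {a} {x} {y} ia e = begin
    x            ≡⟨ sym (*-identityˡ x) ⟩
    1 * x        ≈⟨ ≈-*ʳ x (sym ia) ⟩
    i * a * x    ≡⟨ *-assoc i a x ⟩
    i * (a * x)  ≈⟨ ≈-*ˡ i e ⟩
    i * (a * y)  ≡⟨ sym (*-assoc i a y) ⟩
    i * a * y    ≈⟨ ≈-*ʳ y ia ⟩
    1 * y        ≡⟨ *-identityˡ y ⟩
    y            ∎
    where open ≈-Reasoning

  coprime⇒invertible : ∀ {a} → Coprime a q → ∃ λ i → i * a ≈ 1
  coprime⇒invertible {a} c with coprime-Bézout c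
  ... | GCD.Bézout.+- x y eq = x , (begin
    x * a          ≡⟨ sym eq ⟩
    1 + y * q      ≡⟨ cong (1 +_) (*-comm y q) ⟩
    1 + q * y      ≈⟨ ≈-+ˡ 1 (q*≈0 y) ⟩
    1 + 0          ∎)
    where open ≈-Reasoning
  ... | GCD.Bézout.-+ x y eq = Q * x , +-cancelʳ-≈ q (begin
    Q * x * a + q          ≡⟨ cong (Q * x * a +_) (sym suc-Q) ⟩
    Q * x * a + suc Q      ≡⟨ ring Q x a ⟩
    Q * (1 + x * a) + 1    ≡⟨ cong (λ z → Q * z + 1) (trans eq (*-comm y q)) ⟩
    Q * (q * y) + 1        ≈⟨ ≈-+ʳ 1 (≈-*ˡ Q (q*≈0 y)) ⟩
    Q * 0 + 1              ≡⟨ cong (_+ 1) (*-zeroʳ Q) ⟩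
    1 + 0                  ≈⟨ ≈-+ˡ 1 (sym (∣⇒≈0 ∣-refl)) ⟩
    1 + q                  ∎)
    where
    open ≈-Reasoning
    ring : ∀ Q x a → Q * x * a + suc Q ≡ Q * (1 + x * a) + 1
    ring = solve-∀

toVec : ∀ {m q} → (Fin m → Fin q) → Vec ℕ m
toVec a = Vec.tabulate (toℕ ∘ a)

sumList-tuples : ∀ m q (G : Vec ℕ m → ℕ) → sumList (tuples m (allFin q)) (G ∘ toVec) ≡ sumVec m q G
sumList-tuples zero    q G = +-identityʳ _
sumList-tuples (suc m) q G = begin
  sumList (List.concatMap (λ a → List.map (a VF.∷_) (tuples m (allFin q))) (allFin q)) (G ∘ toVec)
    ≡⟨ sumList-concatMap _ (allFin q) _ ⟩
  sumList (allFin q) (λ a → sumList (List.map (a VF.∷_) (tuples m (allFin q))) (G ∘ toVec))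
    ≡⟨ sumList-cong (allFin q) (λ a → trans (sumList-map _ (tuples m (allFin q)) _) (sumList-tuples m q (λ w → G (toℕ a ∷ w)))) ⟩
  sumList (allFin q) (λ a → sumVec m q (λ w → G (toℕ a ∷ w)))
    ≡⟨ sumList-allFin q (λ a → sumVec m q (λ w → G (a ∷ w))) ⟩
  sumVec (suc m) q G ∎
  where open ≡-Reasoning

column₀ column₁ : ∀ {n q} → Matrix n 2 q → Vec ℕ n
column₀ A = Vec.tabulate (λ i → toℕ (A i Fin.zero))
column₁ A = Vec.tabulate (λ i → toℕ (A i (Fin.suc Fin.zero)))

sumList-matrices : ∀ n q (H : Vec ℕ n → Vec ℕ n → ℕ) →
  sumList (tuples n (tuples 2 (allFin q))) (λ A → H (column₀ A) (column₁ A)) ≡ sumVec n q (λ u → sumVec n q (H u))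
sumList-matrices zero    q H = +-identityʳ _
sumList-matrices (suc n) q H = begin
  sumList (List.concatMap (λ r → List.map (r VF.∷_) (tuples n rows)) rows) (λ A → H (column₀ A) (column₁ A))
    ≡⟨ sumList-concatMap _ rows _ ⟩
  sumList rows (λ r → sumList (List.map (r VF.∷_) (tuples n rows)) (λ A → H (column₀ A) (column₁ A)))
    ≡⟨ sumList-cong rows (λ r → trans (sumList-map _ (tuples n rows) _)
                                      (sumList-matrices n q (λ u v → H (toℕ (r Fin.zero) ∷ u) (toℕ (r (Fin.suc Fin.zero)) ∷ v)))) ⟩
  sumList rows (λ r → sumVec n q (λ u → sumVec n q (λ v → H (toℕ (r Fin.zero) ∷ u) (toℕ (r (Fin.suc Fin.zero)) ∷ v))))
    ≡⟨ sumList-tuples 2 q (λ r → sumVec n q (λ u → sumVec n q (λ v → H (Vec.head r ∷ u) (Vec.head (Vec.tail r) ∷ v)))) ⟩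
  sum< q (λ a → sum< q (λ b → sumVec n q (λ u → sumVec n q (λ v → H (a ∷ u) (b ∷ v)))))
    ≡⟨ sum<-cong q (λ a → sym (sumVec-sum< n q q _)) ⟩
  sumVec (suc n) q (λ u → sumVec (suc n) q (H u)) ∎
  where
  open ≡-Reasoning
  rows : List (Fin 2 → Fin q)
  rows = tuples 2 (allFin q)

-- Kernels of n × 2 systems over ℤ/p^s

module _ {p : ℕ} (p-prime : Prime p) where

  instance
    p≢0 : NonZero p
    p≢0 = prime⇒nonZero p-prime

  1<p : 1 < p
  1<p = nonTrivial⇒n>1 p {{prime⇒nonTrivial p-prime}}

  ^-injective : ∀ {a b} → p ^ a ≡ p ^ b → a ≡ b
  ^-injective {a} {b} eq with <-cmp a b
  ... | tri< a<b _ _ = ⊥-elim (<-irrefl eq (^-monoʳ-< p 1<p a<b))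
  ... | tri≈ _ a≡b _ = a≡b
  ... | tri> _ _ b<a = ⊥-elim (<-irrefl (sym eq) (^-monoʳ-< p 1<p b<a))

  Unit : ℕ → Set
  Unit z = ¬ p ∣ z

  unit? : ∀ z → Dec (Unit z)
  unit? z = ¬? (p ∣? z)

  MinValuation : ∀ {m} → ℕ → Vec ℕ m → Set
  MinValuation e w = All (p ^ e ∣_) w × Any (λ z → ¬ p ^ suc e ∣ z) w

  withUnit : ℕ → ℕ → ℕ
  withUnit k t = sumVec k (p ^ t) (λ w → 𝟙 (any? unit? w))

  𝟙-all-p^0∣ : ∀ {m} (w : Vec ℕ m) → 𝟙 (all? (p ^ 0 ∣?_) w) ≡ 1
  𝟙-all-p^0∣ w = 𝟙-true (all? (p ^ 0 ∣?_) w) (All.universal 1∣_ w)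

  module Level (s : ℕ) where

    q : ℕ
    q = p ^ s

    instance
      q≢0 : NonZero q
      q≢0 = m^n≢0 p s

    open Congruence q

    q≡p^e*p^d : ∀ e d → e + d ≡ s → q ≡ p ^ e * p ^ d
    q≡p^e*p^d e d e+d≡s = trans (cong (p ^_) (sym e+d≡s)) (^-distribˡ-+-* p e d)

    p^e∣q : ∀ {e} → e ≤ s → p ^ e ∣ q
    p^e∣q {e} e≤s = subst (p ^ e ∣_) (sym (q≡p^e*p^d e (s ∸ e) (m+[n∸m]≡n e≤s))) (m∣m*n (p ^ (s ∸ e)))

    Solves : ∀ {n} → Vec ℕ n → Vec ℕ n → ℕ → ℕ → Set
    Solves []      []      x y = ⊤
    Solves (a ∷ u) (b ∷ v) x y = q ∣ a * x + b * y × Solves u v x y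

    solves? : ∀ {n} (u v : Vec ℕ n) x y → Dec (Solves u v x y)
    solves? []      []      x y = yes tt
    solves? (a ∷ u) (b ∷ v) x y = (q ∣? a * x + b * y) ×-dec solves? u v x y

    kernel : ∀ {n} → Vec ℕ n → Vec ℕ n → ℕ
    kernel u v = sum< q (λ x → sum< q (λ y → 𝟙 (solves? u v x y)))

    Solves-swap : ∀ {n} (u v : Vec ℕ n) x y → Solves u v x y → Solves v u y x
    Solves-swap []      []      x y tt      = tt
    Solves-swap (a ∷ u) (b ∷ v) x y (h , r) = subst (q ∣_) (+-comm (a * x) (b * y)) h , Solves-swap u v x y r

    kernel-comm : ∀ {n} (u v : Vec ℕ n) → kernel u v ≡ kernel v u
    kernel-comm u v = trans (sum<-comm q q _)
      (sum<-cong q (λ y → sum<-cong q (λ x → 𝟙-cong (solves? u v x y) (solves? v u y x) (Solves-swap u v x y) (Solves-swap v u y x))))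

    Solves-insertAt⁻ : ∀ {m} (i : Fin (suc m)) a t (u v : Vec ℕ m) x y →
      Solves (insertAt u i a) (insertAt v i t) x y → Solves (a ∷ u) (t ∷ v) x y
    Solves-insertAt⁻ Fin.zero a t u v x y r = r
    Solves-insertAt⁻ {suc m} (Fin.suc i) a t (b ∷ u) (c ∷ v) x y (h , r) with Solves-insertAt⁻ i a t u v x y r
    ... | h′ , r′ = h′ , h , r′

    Solves-insertAt⁺ : ∀ {m} (i : Fin (suc m)) a t (u v : Vec ℕ m) x y →
      Solves (a ∷ u) (t ∷ v) x y → Solves (insertAt u i a) (insertAt v i t) x y
    Solves-insertAt⁺ Fin.zero a t u v x y r = r
    Solves-insertAt⁺ {suc m} (Fin.suc i) a t (b ∷ u) (c ∷ v) x y (h′ , h , r) = h , Solves-insertAt⁺ i a t u v x y (h′ , r)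

    kernel-insertAt : ∀ {m} (i : Fin (suc m)) a t (u v : Vec ℕ m) →
      kernel (insertAt u i a) (insertAt v i t) ≡ kernel (a ∷ u) (t ∷ v)
    kernel-insertAt i a t u v = sum<-cong q (λ x → sum<-cong q (λ y →
      𝟙-cong (solves? _ _ x y) (solves? (a ∷ u) (t ∷ v) x y) (Solves-insertAt⁻ i a t u v x y) (Solves-insertAt⁺ i a t u v x y)))

    Annihilates : ∀ {m} → ℕ → Vec ℕ m → Set
    Annihilates y w = All (λ z → q ∣ y * z) w

    annihilates? : ∀ {m} y (w : Vec ℕ m) → Dec (Annihilates y w)
    annihilates? y w = all? (λ z → q ∣? y * z) w

    annihilator : ∀ {m} → Vec ℕ m → ℕ
    annihilator w = sum< q (λ y → 𝟙 (annihilates? y w))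

    -- a b − t c: what remains of a row (c, b) after eliminating x with the pivot row (a, t).
    reduce : ℕ → ℕ → ℕ → ℕ → ℕ
    reduce a t c b = (a * b + Q * (t * c)) % q

    elimination : ∀ a t c b x y → a * (c * x + b * y) + Q * c * (a * x + t * y) ≈ y * (a * b + Q * (t * c))
    elimination a t c b x y = begin
      a * (c * x + b * y) + Q * c * (a * x + t * y)     ≡⟨ ring Q a c x b y t ⟩
      suc Q * (a * c * x) + y * (a * b + Q * (t * c))   ≡⟨ cong (λ z → z * (a * c * x) + y * (a * b + Q * (t * c))) suc-Q ⟩
      q * (a * c * x) + y * (a * b + Q * (t * c))       ≈⟨ ≈-+ʳ (y * (a * b + Q * (t * c))) (q*≈0 (a * c * x)) ⟩
      y * (a * b + Q * (t * c))                         ∎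
      where
      open ≈-Reasoning
      ring : ∀ Q a c x b y t → a * (c * x + b * y) + Q * c * (a * x + t * y) ≡ suc Q * (a * c * x) + y * (a * b + Q * (t * c))
      ring = solve-∀

    module Pivot (a i t : ℕ) (i*a≈1 : i * a ≈ 1) where

      Solves⇒Annihilates : ∀ {m} (u v : Vec ℕ m) x y → q ∣ a * x + t * y → Solves u v x y →
        Annihilates y (Vec.zipWith (reduce a t) u v)
      Solves⇒Annihilates []      []      x y _     tt      = []
      Solves⇒Annihilates (c ∷ u) (b ∷ v) x y pivot (h , r) = ≈0⇒∣ row ∷ Solves⇒Annihilates u v x y pivot r
        where
        open ≈-Reasoning
        row : y * reduce a t c b ≈ 0
        row = begin
          y * reduce a t c b                               ≈⟨ ≈-*ˡ y (%-≈ (a * b + Q * (t * c))) ⟩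
          y * (a * b + Q * (t * c))                        ≈⟨ sym (elimination a t c b x y) ⟩
          a * (c * x + b * y) + Q * c * (a * x + t * y)    ≈⟨ ≈-+ (≈-*ˡ a (∣⇒≈0 h)) (≈-*ˡ (Q * c) (∣⇒≈0 pivot)) ⟩
          a * 0 + Q * c * 0                                ≡⟨ cong₂ _+_ (*-zeroʳ a) (*-zeroʳ (Q * c)) ⟩
          0                                                ∎

      -- x = −a⁻¹ t y
      pivotSolution : ℕ → ℕ
      pivotSolution y = (Q * (i * (t * y))) % q

      pivotSolution-solves : ∀ y → a * pivotSolution y + t * y ≈ 0
      pivotSolution-solves y = begin
        a * pivotSolution y + t * y           ≈⟨ ≈-+ʳ (t * y) (≈-*ˡ a (%-≈ (Q * (i * (t * y))))) ⟩
        a * (Q * (i * (t * y))) + t * y       ≡⟨ cong (_+ t * y) (ring Q a i (t * y)) ⟩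
        Q * ((i * a) * (t * y)) + t * y       ≈⟨ ≈-+ʳ (t * y) (≈-*ˡ Q (≈-*ʳ (t * y) i*a≈1)) ⟩
        Q * (1 * (t * y)) + t * y             ≡⟨ trans (cong (λ z → Q * z + t * y) (*-identityˡ (t * y))) (+-comm (Q * (t * y)) (t * y)) ⟩
        t * y + Q * (t * y)                   ≈⟨ +-inverse (t * y) ⟩
        0                                     ∎
        where
        open ≈-Reasoning
        ring : ∀ Q a i z → a * (Q * (i * z)) ≡ Q * ((i * a) * z)
        ring = solve-∀

      Annihilates⇒Solves : ∀ {m} (u v : Vec ℕ m) y → Annihilates y (Vec.zipWith (reduce a t) u v) →
        Solves u v (pivotSolution y) y
      Annihilates⇒Solves []      []      y []      = tt
      Annihilates⇒Solves (c ∷ u) (b ∷ v) y (h ∷ r) = ≈0⇒∣ (*-cancelˡ-≈ {i} {a} i*a≈1 row) , Annihilates⇒Solves u v y r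
        where
        open ≈-Reasoning
        x : ℕ
        x = pivotSolution y
        row : a * (c * x + b * y) ≈ a * 0
        row = begin
          a * (c * x + b * y)                              ≡⟨ sym (+-identityʳ _) ⟩
          a * (c * x + b * y) + 0                          ≡⟨ cong (a * (c * x + b * y) +_) (sym (*-zeroʳ (Q * c))) ⟩
          a * (c * x + b * y) + Q * c * 0                  ≈⟨ ≈-+ˡ (a * (c * x + b * y)) (sym (≈-*ˡ (Q * c) (pivotSolution-solves y))) ⟩
          a * (c * x + b * y) + Q * c * (a * x + t * y)    ≈⟨ elimination a t c b x y ⟩
          y * (a * b + Q * (t * c))                        ≈⟨ sym (≈-*ˡ y (%-≈ (a * b + Q * (t * c)))) ⟩
          y * reduce a t c b                               ≈⟨ ∣⇒≈0 h ⟩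
          0                                                ≡⟨ sym (*-zeroʳ a) ⟩
          a * 0                                            ∎

      pivot-unique : ∀ x x′ y → x < q → x′ < q → q ∣ a * x + t * y → q ∣ a * x′ + t * y → x ≡ x′
      pivot-unique x x′ y x<q x′<q h h′ =
        ≈⇒≡ x<q x′<q (*-cancelˡ-≈ {i} {a} i*a≈1 (+-cancelʳ-≈ (t * y) (trans (∣⇒≈0 h) (sym (∣⇒≈0 h′)))))

      kernel-pivot : ∀ {m} (u v : Vec ℕ m) → kernel (a ∷ u) (t ∷ v) ≡ annihilator (Vec.zipWith (reduce a t) u v)
      kernel-pivot u v = trans (sum<-comm q q _) (sum<-cong q solutions-for)
        where
        solutions-for : ∀ y → sum< q (λ x → 𝟙 (solves? (a ∷ u) (t ∷ v) x y)) ≡ 𝟙 (annihilates? y (Vec.zipWith (reduce a t) u v))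
        solutions-for y with annihilates? y (Vec.zipWith (reduce a t) u v)
        ... | yes ann = sum<-𝟙-unique q (λ x → solves? (a ∷ u) (t ∷ v) x y) (pivotSolution y) (m%n<n _ q)
                          (≈0⇒∣ (pivotSolution-solves y) , Annihilates⇒Solves u v y ann)
                          (λ x x<q (h , _) → pivot-unique x (pivotSolution y) y x<q (m%n<n _ q) h (≈0⇒∣ (pivotSolution-solves y)))
        ... | no ¬ann = trans (sum<-cong q (λ x → 𝟙-false (solves? (a ∷ u) (t ∷ v) x y) (λ (h , r) → ¬ann (Solves⇒Annihilates u v x y h r))))
                              (sum<-zero q)

      unreduce : ℕ → ℕ → ℕ
      unreduce c z = (i * (z + t * c)) % q

      unreduce-reduce : ∀ c b → b < q → unreduce c (reduce a t c b) ≡ b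
      unreduce-reduce c b b<q = ≈⇒%≡ b<q (begin
        i * (reduce a t c b + t * c)                 ≈⟨ ≈-*ˡ i (≈-+ʳ (t * c) (%-≈ (a * b + Q * (t * c)))) ⟩
        i * (a * b + Q * (t * c) + t * c)            ≡⟨ ring i a b Q (t * c) ⟩
        (i * a) * b + i * (suc Q * (t * c))          ≡⟨ cong (λ z → (i * a) * b + i * (z * (t * c))) suc-Q ⟩
        (i * a) * b + i * (q * (t * c))              ≈⟨ ≈-+ (≈-*ʳ b i*a≈1) (≈-*ˡ i (q*≈0 (t * c))) ⟩
        1 * b + i * 0                                ≡⟨ cong₂ _+_ (*-identityˡ b) (*-zeroʳ i) ⟩
        b + 0                                        ≡⟨ +-identityʳ b ⟩
        b                                            ∎)
        where
        open ≈-Reasoning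
        ring : ∀ i a b Q z → i * (a * b + Q * z + z) ≡ (i * a) * b + i * (suc Q * z)
        ring = solve-∀

      reduce-unreduce : ∀ c z → z < q → reduce a t c (unreduce c z) ≡ z
      reduce-unreduce c z z<q = ≈⇒%≡ z<q (begin
        a * unreduce c z + Q * (t * c)               ≈⟨ ≈-+ʳ (Q * (t * c)) (≈-*ˡ a (%-≈ (i * (z + t * c)))) ⟩
        a * (i * (z + t * c)) + Q * (t * c)          ≡⟨ cong (_+ Q * (t * c)) (ring a i (z + t * c)) ⟩
        (i * a) * (z + t * c) + Q * (t * c)          ≈⟨ ≈-+ʳ (Q * (t * c)) (≈-*ʳ (z + t * c) i*a≈1) ⟩
        1 * (z + t * c) + Q * (t * c)                ≡⟨ trans (cong (_+ Q * (t * c)) (*-identityˡ (z + t * c))) (+-assoc z (t * c) (Q * (t * c))) ⟩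
        z + (t * c + Q * (t * c))                    ≈⟨ ≈-+ˡ z (+-inverse (t * c)) ⟩
        z + 0                                        ≡⟨ +-identityʳ z ⟩
        z                                            ∎)
        where
        open ≈-Reasoning
        ring : ∀ a i z → a * (i * z) ≡ (i * a) * z
        ring = solve-∀

    reduce-∣⁻ : ∀ δ a t c b → δ ≤ s → Unit a → p ^ δ ∣ t → p ^ δ ∣ reduce a t c b → p ^ δ ∣ b
    reduce-∣⁻ δ a t c b δ≤s a-unit p^δ∣t p^δ∣r =
      coprime-divisor (Coprimality.sym (coprime-^ (∤⇒coprime p-prime a-unit) δ))
        (∣m+n∣m⇒∣n (subst (p ^ δ ∣_) (+-comm (a * b) (Q * (t * c))) (∣n∣m%n⇒∣m (p^e∣q δ≤s) p^δ∣r))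
                   (∣n⇒∣m*n Q (∣m⇒∣m*n c p^δ∣t)))

    reduce-∣⁺ : ∀ δ a t c b → δ ≤ s → p ^ δ ∣ t → p ^ δ ∣ b → p ^ δ ∣ reduce a t c b
    reduce-∣⁺ δ a t c b δ≤s p^δ∣t p^δ∣b =
      %-presˡ-∣ (∣m∣n⇒∣m+n (∣n⇒∣m*n a p^δ∣b) (∣n⇒∣m*n Q (∣m⇒∣m*n c p^δ∣t))) (p^e∣q δ≤s)

    All-reduce⁻ : ∀ {m} δ a t (u v : Vec ℕ m) → δ ≤ s → Unit a → p ^ δ ∣ t →
      All (p ^ δ ∣_) (Vec.zipWith (reduce a t) u v) → All (p ^ δ ∣_) v
    All-reduce⁻ δ a t []      []      _   _ _ []      = []
    All-reduce⁻ δ a t (c ∷ u) (b ∷ v) δ≤s ua ht (h ∷ hs) = reduce-∣⁻ δ a t c b δ≤s ua ht h ∷ All-reduce⁻ δ a t u v δ≤s ua ht hs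

    All-reduce⁺ : ∀ {m} δ a t (u v : Vec ℕ m) → δ ≤ s → p ^ δ ∣ t →
      All (p ^ δ ∣_) v → All (p ^ δ ∣_) (Vec.zipWith (reduce a t) u v)
    All-reduce⁺ δ a t []      []      _   _ []      = []
    All-reduce⁺ δ a t (c ∷ u) (b ∷ v) δ≤s ht (h ∷ hs) = reduce-∣⁺ δ a t c b δ≤s ht h ∷ All-reduce⁺ δ a t u v δ≤s ht hs

    ∣y*z⇒∣y : ∀ e d {y z} → e + d ≡ s → p ^ e ∣ z → ¬ p ^ suc e ∣ z → q ∣ y * z → p ^ d ∣ y
    ∣y*z⇒∣y e d {y} e+d≡s (divides k refl) ¬p^e+1∣z q∣yz =
      coprime-divisor (Coprimality.sym (coprime-^ (∤⇒coprime p-prime p∤k) d)) p^d∣ky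
      where
      p∤k : ¬ p ∣ k
      p∤k (divides l refl) = ¬p^e+1∣z (divides l (*-assoc l p (p ^ e)))
      p^d∣ky : p ^ d ∣ k * y
      p^d∣ky = *-cancelʳ-∣ (p ^ e) {{m^n≢0 p e}}
        (subst₂ _∣_ (trans (q≡p^e*p^d e d e+d≡s) (*-comm (p ^ e) (p ^ d))) (rearrange y k (p ^ e)) q∣yz)
        where
        rearrange : ∀ y k P → y * (k * P) ≡ k * y * P
        rearrange = solve-∀

    annihilates⇒ : ∀ {m} e d {y} (w : Vec ℕ m) → e + d ≡ s → MinValuation e w → Annihilates y w → p ^ d ∣ y
    annihilates⇒ e d (z ∷ w) e+d≡s (_ ∷ all , there any)        (_ ∷ ann)    = annihilates⇒ e d w e+d≡s (all , any) ann
    annihilates⇒ e d (z ∷ w) e+d≡s (p^e∣z ∷ _ , here ¬p^e+1∣z) (q∣yz ∷ _) = ∣y*z⇒∣y e d e+d≡s p^e∣z ¬p^e+1∣z q∣yz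

    annihilates⇐ : ∀ {m} e d {y} (w : Vec ℕ m) → e + d ≡ s → All (p ^ e ∣_) w → p ^ d ∣ y → Annihilates y w
    annihilates⇐ e d {y} w e+d≡s all p^d∣y = All.map q∣y*z all
      where
      q∣y*z : ∀ {z} → p ^ e ∣ z → q ∣ y * z
      q∣y*z p^e∣z = subst (_∣ _) (trans (*-comm (p ^ d) (p ^ e)) (sym (q≡p^e*p^d e d e+d≡s))) (*-pres-∣ p^d∣y p^e∣z)

    annihilator-minValuation : ∀ {m} e d (w : Vec ℕ m) → e + d ≡ s → MinValuation e w → annihilator w ≡ p ^ e
    annihilator-minValuation e d w e+d≡s minVal = begin
      sum< q (λ y → 𝟙 (annihilates? y w))     ≡⟨ sum<-cong q (λ y → 𝟙-cong (annihilates? y w) (p ^ d ∣? y)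
                                                    (annihilates⇒ e d w e+d≡s minVal) (annihilates⇐ e d w e+d≡s (proj₁ minVal))) ⟩
      sum< q (𝟙 ∘ (p ^ d ∣?_))               ≡⟨ cong (λ r → sum< r (𝟙 ∘ (p ^ d ∣?_))) (q≡p^e*p^d e d e+d≡s) ⟩
      sum< (p ^ e * p ^ d) (𝟙 ∘ (p ^ d ∣?_)) ≡⟨ count-multiples (p ^ e) (p ^ d) {{m^n≢0 p d}} ⟩
      p ^ e                                  ∎
      where open ≡-Reasoning

    annihilator-all-∣q : ∀ {m} (w : Vec ℕ m) → All (q ∣_) w → annihilator w ≡ q
    annihilator-all-∣q w all = begin
      sum< q (λ y → 𝟙 (annihilates? y w))  ≡⟨ sum<-cong q (λ y → 𝟙-true (annihilates? y w) (All.map (∣n⇒∣m*n y) all)) ⟩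
      sum< q (λ _ → 1)                    ≡⟨ trans (sum<-const q 1) (*-identityʳ q) ⟩
      q                                   ∎
      where open ≡-Reasoning

    valuation-cases : ∀ {m} (w : Vec ℕ m) k d → k + d ≡ s → All (p ^ k ∣_) w →
      All (q ∣_) w ⊎ ∃₂ λ e d′ → e + d′ ≡ s × MinValuation e w
    valuation-cases w k zero    k+0≡s all = inj₁ (subst (λ e → All (p ^ e ∣_) w) (trans (sym (+-identityʳ k)) k+0≡s) all)
    valuation-cases w k (suc d) k+d≡s all with all? (p ^ suc k ∣?_) w
    ... | yes all′ = valuation-cases w (suc k) d (trans (sym (+-suc k d)) k+d≡s) all′
    ... | no ¬all′ = inj₂ (k , suc d , k+d≡s , all , ¬All⇒Any¬ (p ^ suc k ∣?_) w ¬all′)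

    annihilator≡p^j⇒minValuation : ∀ {m} j (w : Vec ℕ m) → j < s → annihilator w ≡ p ^ j → MinValuation j w
    annihilator≡p^j⇒minValuation j w j<s ann≡p^j with valuation-cases w 0 s refl (All.universal 1∣_ w)
    ... | inj₁ all = ⊥-elim (<-irrefl (sym (^-injective {s} {j} (trans (sym (annihilator-all-∣q w all)) ann≡p^j))) j<s)
    ... | inj₂ (e , d , e+d≡s , minVal) =
      subst (λ k → MinValuation k w) (^-injective {e} {j} (trans (sym (annihilator-minValuation e d w e+d≡s minVal)) ann≡p^j)) minVal

    count-divisible : ∀ e d → e + d ≡ s → sum< q (𝟙 ∘ (p ^ e ∣?_)) ≡ p ^ d
    count-divisible e d e+d≡s =
      trans (cong (λ r → sum< r (𝟙 ∘ (p ^ e ∣?_))) (trans (q≡p^e*p^d e d e+d≡s) (*-comm (p ^ e) (p ^ d))))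
            (count-multiples (p ^ d) (p ^ e) {{m^n≢0 p e}})

    count-all-divisible : ∀ m e d → e + d ≡ s → sumVec m q (λ w → 𝟙 (all? (p ^ e ∣?_) w)) ≡ (p ^ d) ^ m
    count-all-divisible m e d e+d≡s = trans (sumVec-all m q (p ^ e ∣?_)) (cong (_^ m) (count-divisible e d e+d≡s))

    𝟙-all-divisible-split : ∀ {m} j d (w : Vec ℕ m) → j + suc d ≡ s →
      𝟙 (all? (p ^ j ∣?_) w) ≡ 𝟙 (annihilator w ≟ p ^ j) + 𝟙 (all? (p ^ suc j ∣?_) w)
    𝟙-all-divisible-split j d w j+d+1≡s =
      𝟙-⊎ (all? (p ^ j ∣?_) w) (annihilator w ≟ p ^ j) (all? (p ^ suc j ∣?_) w)
        cases (proj₁ ∘ minValuation) (All.map (∣-trans (divides p refl))) (Any¬⇒¬All ∘ proj₂ ∘ minValuation)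
      where
      j<s : j < s
      j<s = subst (j <_) j+d+1≡s (m<m+n j (s≤s z≤n))
      minValuation : annihilator w ≡ p ^ j → MinValuation j w
      minValuation = annihilator≡p^j⇒minValuation j w j<s
      cases : All (p ^ j ∣_) w → annihilator w ≡ p ^ j ⊎ All (p ^ suc j ∣_) w
      cases all with all? (p ^ suc j ∣?_) w
      ... | yes all′ = inj₂ all′
      ... | no ¬all′ = inj₁ (annihilator-minValuation j (suc d) w j+d+1≡s (all , ¬All⇒Any¬ (p ^ suc j ∣?_) w ¬all′))

    annihilatorCount : ℕ → ℕ → ℕ → ℕ
    annihilatorCount δ m j = sumVec m q (λ w → 𝟙 (all? (p ^ δ ∣?_) w) * 𝟙 (annihilator w ≟ p ^ j))

    annihilatorCount-0 : ∀ m j d → j + suc d ≡ s → annihilatorCount 0 m j + (p ^ d) ^ m ≡ (p ^ suc d) ^ m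
    annihilatorCount-0 m j d j+d+1≡s = begin
      annihilatorCount 0 m j + (p ^ d) ^ m
        ≡⟨ cong₂ _+_ (sumVec-cong m q (λ w → trans (cong (_* 𝟙 (annihilator w ≟ p ^ j)) (𝟙-all-p^0∣ w)) (*-identityˡ _)))
                     (sym (count-all-divisible m (suc j) d (trans (sym (+-suc j d)) j+d+1≡s))) ⟩
      sumVec m q (λ w → 𝟙 (annihilator w ≟ p ^ j)) + sumVec m q (λ w → 𝟙 (all? (p ^ suc j ∣?_) w))
        ≡⟨ sym (sumVec-+ m q _ _) ⟩
      sumVec m q (λ w → 𝟙 (annihilator w ≟ p ^ j) + 𝟙 (all? (p ^ suc j ∣?_) w))
        ≡⟨ sumVec-cong m q (λ w → sym (𝟙-all-divisible-split j d w j+d+1≡s)) ⟩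
      sumVec m q (λ w → 𝟙 (all? (p ^ j ∣?_) w))
        ≡⟨ count-all-divisible m j (suc d) j+d+1≡s ⟩
      (p ^ suc d) ^ m ∎
      where open ≡-Reasoning

    annihilatorCount-1-zero : ∀ m → 0 < s → annihilatorCount 1 m 0 ≡ 0
    annihilatorCount-1-zero m 0<s = trans (sumVec-cong m q vanishes) (sumVec-zero m q)
      where
      vanishes : ∀ w → 𝟙 (all? (p ^ 1 ∣?_) w) * 𝟙 (annihilator w ≟ p ^ 0) ≡ 0
      vanishes w with annihilator w ≟ p ^ 0
      ... | yes ann≡1 = trans (*-identityʳ (𝟙 (all? (p ^ 1 ∣?_) w))) (𝟙-false (all? (p ^ 1 ∣?_) w)
                          (Any¬⇒¬All (proj₂ (annihilator≡p^j⇒minValuation 0 w 0<s ann≡1))))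
      ... | no _      = *-zeroʳ (𝟙 (all? (p ^ 1 ∣?_) w))

    annihilatorCount-1-suc : ∀ m j → suc j < s → annihilatorCount 1 m (suc j) ≡ annihilatorCount 0 m (suc j)
    annihilatorCount-1-suc m j j+1<s = sumVec-cong m q agree
      where
      agree : ∀ w → 𝟙 (all? (p ^ 1 ∣?_) w) * 𝟙 (annihilator w ≟ p ^ suc j) ≡ 𝟙 (all? (p ^ 0 ∣?_) w) * 𝟙 (annihilator w ≟ p ^ suc j)
      agree w with annihilator w ≟ p ^ suc j
      ... | no _      = trans (*-zeroʳ (𝟙 (all? (p ^ 1 ∣?_) w))) (sym (*-zeroʳ (𝟙 (all? (p ^ 0 ∣?_) w))))
      ... | yes ann≡p^j+1 = cong (_* 1) (trans
            (𝟙-true (all? (p ^ 1 ∣?_) w) (All.map (∣-trans (p^1∣p^j+1)) (proj₁ (annihilator≡p^j⇒minValuation (suc j) w j+1<s ann≡p^j+1))))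
            (sym (𝟙-all-p^0∣ w)))
        where
        p^1∣p^j+1 : p ^ 1 ∣ p ^ suc j
        p^1∣p^j+1 = *-monoʳ-∣ p (1∣ _)

    annihilatorCount-reduce : ∀ {m} δ j a t (u′ : Vec ℕ m) → δ ≤ s → Unit a → p ^ δ ∣ t →
      sumVec m q (λ v → 𝟙 (all? (p ^ δ ∣?_) v) * 𝟙 (annihilator (Vec.zipWith (reduce a t) u′ v) ≟ p ^ j))
        ≡ annihilatorCount δ m j
    annihilatorCount-reduce {m} δ j a t u′ δ≤s a-unit p^δ∣t = trans
      (sumVec-cong m q (λ v → cong (_* 𝟙 (annihilator (Vec.zipWith (reduce a t) u′ v) ≟ p ^ j))
        (𝟙-cong (all? (p ^ δ ∣?_) v) (all? (p ^ δ ∣?_) (Vec.zipWith (reduce a t) u′ v))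
                (All-reduce⁺ δ a t u′ v δ≤s p^δ∣t) (All-reduce⁻ δ a t u′ v δ≤s a-unit p^δ∣t))))
      (sumVec-bijection m q (reduce a t) unreduce (λ _ _ _ → m%n<n _ q) (λ _ _ _ → m%n<n _ q) unreduce-reduce reduce-unreduce u′ _)
      where
      inverse : ∃ λ i → i * a ≈ 1
      inverse = coprime⇒invertible (coprime-^ (∤⇒coprime p-prime a-unit) s)
      open Pivot a (proj₁ inverse) t (proj₂ inverse)

    -- Split v at the row of a unit entry a of u, then eliminate x with that row.
    kernelCount-unit : ∀ {m} δ c j → δ + c ≡ s → (u : Vec ℕ (suc m)) → Any Unit u →
      sumVec (suc m) q (λ v → 𝟙 (all? (p ^ δ ∣?_) v) * 𝟙 (kernel u v ≟ p ^ j)) ≡ p ^ c * annihilatorCount δ m j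
    kernelCount-unit {m} δ c j δ+c≡s u any with Any⇒insertAt u any
    ... | i , a , u′ , refl , a-unit = begin
      sumVec (suc m) q (λ v → 𝟙 (all? (p ^ δ ∣?_) v) * 𝟙 (kernel (insertAt u′ i a) v ≟ p ^ j))
        ≡⟨ sumVec-insertAt m q i (λ v → 𝟙 (all? (p ^ δ ∣?_) v) * 𝟙 (kernel (insertAt u′ i a) v ≟ p ^ j)) ⟩
      sum< q (λ t → sumVec m q (λ v → 𝟙 (all? (p ^ δ ∣?_) (insertAt v i t)) * 𝟙 (kernel (insertAt u′ i a) (insertAt v i t) ≟ p ^ j)))
        ≡⟨ sum<-cong q (λ t → trans (sumVec-cong m q (factor t)) (sumVec-*ˡ m q (𝟙 (p ^ δ ∣? t)) _)) ⟩
      sum< q (λ t → 𝟙 (p ^ δ ∣? t) * reduced t)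
        ≡⟨ sum<-cong q (λ t → on-divisible t (p ^ δ ∣? t)) ⟩
      sum< q (λ t → 𝟙 (p ^ δ ∣? t) * annihilatorCount δ m j)
        ≡⟨ sum<-*ʳ q _ _ ⟩
      sum< q (𝟙 ∘ (p ^ δ ∣?_)) * annihilatorCount δ m j
        ≡⟨ cong (_* annihilatorCount δ m j) (count-divisible δ c δ+c≡s) ⟩
      p ^ c * annihilatorCount δ m j ∎
      where
      open ≡-Reasoning
      inverse : ∃ λ i → i * a ≈ 1
      inverse = coprime⇒invertible (coprime-^ (∤⇒coprime p-prime a-unit) s)
      reduced : ℕ → ℕ
      reduced t = sumVec m q (λ v → 𝟙 (all? (p ^ δ ∣?_) v) * 𝟙 (annihilator (Vec.zipWith (reduce a t) u′ v) ≟ p ^ j))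
      factor : ∀ t v → 𝟙 (all? (p ^ δ ∣?_) (insertAt v i t)) * 𝟙 (kernel (insertAt u′ i a) (insertAt v i t) ≟ p ^ j)
                         ≡ 𝟙 (p ^ δ ∣? t) * (𝟙 (all? (p ^ δ ∣?_) v) * 𝟙 (annihilator (Vec.zipWith (reduce a t) u′ v) ≟ p ^ j))
      factor t v = trans
        (cong₂ _*_ (𝟙-all-insertAt (p ^ δ ∣?_) i t v)
                   (cong (λ k → 𝟙 (k ≟ p ^ j)) (trans (kernel-insertAt i a t u′ v) (Pivot.kernel-pivot a (proj₁ inverse) t (proj₂ inverse) u′ v))))
        (*-assoc (𝟙 (p ^ δ ∣? t)) _ _)
      on-divisible : ∀ t (d : Dec (p ^ δ ∣ t)) → 𝟙 d * reduced t ≡ 𝟙 d * annihilatorCount δ m j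
      on-divisible t (yes p^δ∣t) = cong (1 *_) (annihilatorCount-reduce δ j a t u′ (subst (δ ≤_) δ+c≡s (m≤m+n δ c)) a-unit p^δ∣t)
      on-divisible t (no _)      = refl

    Any-unit⇒¬All-p∣ : ∀ {k} (w : Vec ℕ k) → Any Unit w → ¬ All (p ^ 1 ∣_) w
    Any-unit⇒¬All-p∣ w any = Any¬⇒¬All (Any.map (λ p∤z p^1∣z → p∤z (subst (_∣ _) (*-identityʳ p) p^1∣z)) any)

    ¬All-p∣⇒Any-unit : ∀ {k} (w : Vec ℕ k) → ¬ All (p ^ 1 ∣_) w → Any Unit w
    ¬All-p∣⇒Any-unit w ¬all = Any.map (λ ¬p^1∣z p∣z → ¬p^1∣z (subst (_∣ _) (sym (*-identityʳ p)) p∣z)) (¬All⇒Any¬ (p ^ 1 ∣?_) w ¬all)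

    sumVec-unit-split : ∀ k (H : Vec ℕ k → ℕ) →
      sumVec k q H ≡ sumVec k q (λ w → 𝟙 (any? unit? w) * H w) + sumVec k q (λ w → 𝟙 (all? (p ^ 1 ∣?_) w) * H w)
    sumVec-unit-split k = sumVec-complement k q (any? unit?) (all? (p ^ 1 ∣?_)) Any-unit⇒¬All-p∣ ¬All-p∣⇒Any-unit

    withUnit-+ : ∀ k s′ → 1 + s′ ≡ s → withUnit k s + (p ^ s′) ^ k ≡ (p ^ s) ^ k
    withUnit-+ k s′ 1+s′≡s = begin
      withUnit k s + (p ^ s′) ^ k
        ≡⟨ cong (withUnit k s +_) (sym (count-all-divisible k 1 s′ 1+s′≡s)) ⟩
      withUnit k s + sumVec k q (λ w → 𝟙 (all? (p ^ 1 ∣?_) w))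
        ≡⟨ trans (cong₂ _+_ (sumVec-cong k q (λ w → sym (*-identityʳ _))) (sumVec-cong k q (λ w → sym (*-identityʳ _))))
                 (sym (sumVec-unit-split k (λ _ → 1))) ⟩
      sumVec k q (λ _ → 1)
        ≡⟨ sumVec-one k q ⟩
      q ^ k ∎
      where open ≡-Reasoning

    pairsWithKernel : ℕ → ℕ → ℕ
    pairsWithKernel n j = sumVec n q (λ u → sumVec n q (λ v → 𝟙 (kernel u v ≟ p ^ j)))

    divisiblePairsWithKernel : ℕ → ℕ → ℕ
    divisiblePairsWithKernel n j =
      sumVec n q (λ u → 𝟙 (all? (p ^ 1 ∣?_) u) * sumVec n q (λ v → 𝟙 (all? (p ^ 1 ∣?_) v) * 𝟙 (kernel u v ≟ p ^ j)))

    -- Split on whether u has an entry prime to p and, if it does not, whether v has one.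
    pairsWithKernel-decomposition : ∀ m j s′ → 1 + s′ ≡ s →
      pairsWithKernel (suc m) j
        ≡ withUnit (suc m) s * (p ^ s * annihilatorCount 0 m j) + withUnit (suc m) s * (p ^ s′ * annihilatorCount 1 m j)
          + divisiblePairsWithKernel (suc m) j
    pairsWithKernel-decomposition m j s′ 1+s′≡s = begin
      sumVec n q (λ u → K u)
        ≡⟨ sumVec-unit-split n K ⟩
      sumVec n q (λ u → 𝟙 (any? unit? u) * K u) + sumVec n q (λ u → 𝟙 (all? (p ^ 1 ∣?_) u) * K u)
        ≡⟨ cong₂ _+_ (sumVec-𝟙-*-const n q (any? unit?) K _ first-column-unit)
                     (sumVec-cong n q (λ u → cong (𝟙 (all? (p ^ 1 ∣?_) u) *_) (sumVec-unit-split n (λ v → 𝟙 (kernel u v ≟ p ^ j))))) ⟩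
      withUnit n s * (p ^ s * annihilatorCount 0 m j) + sumVec n q (λ u → 𝟙 (all? (p ^ 1 ∣?_) u) * (K₁ u + K₂ u))
        ≡⟨ cong (withUnit n s * (p ^ s * annihilatorCount 0 m j) +_)
                (trans (sumVec-cong n q (λ u → *-distribˡ-+ (𝟙 (all? (p ^ 1 ∣?_) u)) (K₁ u) (K₂ u)))
                       (sumVec-+ n q (λ u → 𝟙 (all? (p ^ 1 ∣?_) u) * K₁ u) (λ u → 𝟙 (all? (p ^ 1 ∣?_) u) * K₂ u))) ⟩
      withUnit n s * (p ^ s * annihilatorCount 0 m j)
        + (sumVec n q (λ u → 𝟙 (all? (p ^ 1 ∣?_) u) * K₁ u) + divisiblePairsWithKernel n j)
        ≡⟨ cong (λ z → withUnit n s * (p ^ s * annihilatorCount 0 m j) + (z + divisiblePairsWithKernel n j))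
                (trans (sumVec-*-comm n q (𝟙 ∘ all? (p ^ 1 ∣?_)) (𝟙 ∘ any? unit?) (λ u v → 𝟙 (kernel u v ≟ p ^ j)))
                       (sumVec-𝟙-*-const n q (any? unit?) _ _ second-column-unit)) ⟩
      withUnit n s * (p ^ s * annihilatorCount 0 m j)
        + (withUnit n s * (p ^ s′ * annihilatorCount 1 m j) + divisiblePairsWithKernel n j)
        ≡⟨ sym (+-assoc (withUnit n s * (p ^ s * annihilatorCount 0 m j)) _ _) ⟩
      withUnit n s * (p ^ s * annihilatorCount 0 m j) + withUnit n s * (p ^ s′ * annihilatorCount 1 m j)
        + divisiblePairsWithKernel n j ∎
      where
      open ≡-Reasoning
      n : ℕ
      n = suc m
      K K₁ K₂ : Vec ℕ n → ℕ
      K  u = sumVec n q (λ v → 𝟙 (kernel u v ≟ p ^ j))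
      K₁ u = sumVec n q (λ v → 𝟙 (any? unit? v) * 𝟙 (kernel u v ≟ p ^ j))
      K₂ u = sumVec n q (λ v → 𝟙 (all? (p ^ 1 ∣?_) v) * 𝟙 (kernel u v ≟ p ^ j))
      first-column-unit : ∀ u → Any Unit u → K u ≡ p ^ s * annihilatorCount 0 m j
      first-column-unit u any =
        trans (sumVec-cong n q (λ v → sym (trans (cong (_* 𝟙 (kernel u v ≟ p ^ j)) (𝟙-all-p^0∣ v)) (*-identityˡ _))))
              (kernelCount-unit 0 s j refl u any)
      second-column-unit : ∀ v → Any Unit v →
        sumVec n q (λ u → 𝟙 (all? (p ^ 1 ∣?_) u) * 𝟙 (kernel u v ≟ p ^ j)) ≡ p ^ s′ * annihilatorCount 1 m j
      second-column-unit v any =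
        trans (sumVec-cong n q (λ u → cong (λ k → 𝟙 (all? (p ^ 1 ∣?_) u) * 𝟙 (k ≟ p ^ j)) (kernel-comm u v)))
              (kernelCount-unit 1 s′ j 1+s′≡s v any)

  -- Columns divisible by p: from ℤ/p^(s′+1) down to ℤ/p^s′

  module Scaling (s′ : ℕ) where
    module High = Level (suc s′)
    module Low  = Level s′

    instance
      p^s′≢0 : NonZero (p ^ s′)
      p^s′≢0 = m^n≢0 p s′
      p^1≢0 : NonZero (p ^ 1)
      p^1≢0 = m^n≢0 p 1

    open Congruence (p ^ s′) using (≈-+; ≈-*ˡ; %-≈; ∣⇒≈0; ≈0⇒∣)

    p^s′+1≡p^1*p^s′ : p ^ suc s′ ≡ p ^ 1 * p ^ s′
    p^s′+1≡p^1*p^s′ = ^-distribˡ-+-* p 1 s′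

    row-scale : ∀ a b x y → p ^ 1 * a * x + p ^ 1 * b * y ≡ p ^ 1 * (a * x + b * y)
    row-scale a b x y = ring (p ^ 1) a b x y
      where
      ring : ∀ d a b x y → d * a * x + d * b * y ≡ d * (a * x + b * y)
      ring = solve-∀

    Solves-scale⁻ : ∀ {k} (u v : Vec ℕ k) x y →
      High.Solves (Vec.map (p ^ 1 *_) u) (Vec.map (p ^ 1 *_) v) x y → Low.Solves u v (x % p ^ s′) (y % p ^ s′)
    Solves-scale⁻ []      []      x y tt      = tt
    Solves-scale⁻ (a ∷ u) (b ∷ v) x y (h , r) =
      ≈0⇒∣ (trans (≈-+ (≈-*ˡ a (%-≈ x)) (≈-*ˡ b (%-≈ y))) (∣⇒≈0 row)) , Solves-scale⁻ u v x y r
      where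
      row : p ^ s′ ∣ a * x + b * y
      row = *-cancelˡ-∣ (p ^ 1) (subst₂ _∣_ p^s′+1≡p^1*p^s′ (row-scale a b x y) h)

    Solves-scale⁺ : ∀ {k} (u v : Vec ℕ k) x y →
      Low.Solves u v (x % p ^ s′) (y % p ^ s′) → High.Solves (Vec.map (p ^ 1 *_) u) (Vec.map (p ^ 1 *_) v) x y
    Solves-scale⁺ []      []      x y tt      = tt
    Solves-scale⁺ (a ∷ u) (b ∷ v) x y (h , r) =
      subst₂ _∣_ (sym p^s′+1≡p^1*p^s′) (sym (row-scale a b x y)) (*-monoʳ-∣ (p ^ 1) row) , Solves-scale⁺ u v x y r
      where
      row : p ^ s′ ∣ a * x + b * y
      row = ≈0⇒∣ (trans (sym (≈-+ (≈-*ˡ a (%-≈ x)) (≈-*ˡ b (%-≈ y)))) (∣⇒≈0 h))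

    -- The solutions modulo p^(s′+1) are the p² lifts of the solutions modulo p^s′.
    kernel-scale : ∀ {k} (u v : Vec ℕ k) →
      High.kernel (Vec.map (p ^ 1 *_) u) (Vec.map (p ^ 1 *_) v) ≡ p * (p * Low.kernel u v)
    kernel-scale u v = begin
      sum< (p ^ suc s′) (λ x → sum< (p ^ suc s′) (λ y → 𝟙 (High.solves? (Vec.map (p ^ 1 *_) u) (Vec.map (p ^ 1 *_) v) x y)))
        ≡⟨ sum<-cong (p ^ suc s′) (λ x → sum<-cong (p ^ suc s′) (λ y →
             𝟙-cong (High.solves? _ _ x y) (Low.solves? u v (x % p ^ s′) (y % p ^ s′)) (Solves-scale⁻ u v x y) (Solves-scale⁺ u v x y))) ⟩
      sum< (p ^ suc s′) (λ x → sum< (p ^ suc s′) (λ y → solves (x % p ^ s′) (y % p ^ s′)))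
        ≡⟨ cong (λ r → sum< r (λ x → sum< r (λ y → solves (x % p ^ s′) (y % p ^ s′)))) p^s′+1≡p^1*p^s′ ⟩
      sum< (p ^ 1 * p ^ s′) (λ x → sum< (p ^ 1 * p ^ s′) (λ y → solves (x % p ^ s′) (y % p ^ s′)))
        ≡⟨ sum<-cong (p ^ 1 * p ^ s′) (λ x → sum<-% (p ^ 1) (p ^ s′) (solves (x % p ^ s′))) ⟩
      sum< (p ^ 1 * p ^ s′) (λ x → p ^ 1 * sum< (p ^ s′) (solves (x % p ^ s′)))
        ≡⟨ sum<-*ˡ (p ^ 1 * p ^ s′) (p ^ 1) _ ⟩
      p ^ 1 * sum< (p ^ 1 * p ^ s′) (λ x → sum< (p ^ s′) (solves (x % p ^ s′)))
        ≡⟨ cong (p ^ 1 *_) (sum<-% (p ^ 1) (p ^ s′) (λ x → sum< (p ^ s′) (solves x))) ⟩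
      p ^ 1 * (p ^ 1 * Low.kernel u v)
        ≡⟨ cong₂ (λ a b → a * (b * Low.kernel u v)) (*-identityʳ p) (*-identityʳ p) ⟩
      p * (p * Low.kernel u v) ∎
      where
      open ≡-Reasoning
      solves : ℕ → ℕ → ℕ
      solves x y = 𝟙 (Low.solves? u v x y)

    divisiblePairsWithKernel-scale : ∀ k j →
      High.divisiblePairsWithKernel k j ≡ sumVec k (p ^ s′) (λ u → sumVec k (p ^ s′) (λ v → 𝟙 (p * (p * Low.kernel u v) ≟ p ^ j)))
    divisiblePairsWithKernel-scale k j = begin
      High.divisiblePairsWithKernel k j
        ≡⟨ cong (λ r → sumVec k r (λ u → 𝟙 (all? (p ^ 1 ∣?_) u) * sumVec k r (λ v → 𝟙 (all? (p ^ 1 ∣?_) v) * 𝟙 (High.kernel u v ≟ p ^ j))))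
                (trans p^s′+1≡p^1*p^s′ (*-comm (p ^ 1) (p ^ s′))) ⟩
      sumVec k (p ^ s′ * p ^ 1) (λ u → 𝟙 (all? (p ^ 1 ∣?_) u) * sumVec k (p ^ s′ * p ^ 1) (λ v → 𝟙 (all? (p ^ 1 ∣?_) v) * 𝟙 (High.kernel u v ≟ p ^ j)))
        ≡⟨ sumVec-multiples k (p ^ s′) (p ^ 1) _ ⟩
      sumVec k (p ^ s′) (λ u → sumVec k (p ^ s′ * p ^ 1) (λ v → 𝟙 (all? (p ^ 1 ∣?_) v) * 𝟙 (High.kernel (Vec.map (p ^ 1 *_) u) v ≟ p ^ j)))
        ≡⟨ sumVec-cong k (p ^ s′) (λ u → sumVec-multiples k (p ^ s′) (p ^ 1) _) ⟩
      sumVec k (p ^ s′) (λ u → sumVec k (p ^ s′) (λ v → 𝟙 (High.kernel (Vec.map (p ^ 1 *_) u) (Vec.map (p ^ 1 *_) v) ≟ p ^ j)))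
        ≡⟨ sumVec-cong k (p ^ s′) (λ u → sumVec-cong k (p ^ s′) (λ v → cong (λ r → 𝟙 (r ≟ p ^ j)) (kernel-scale u v))) ⟩
      sumVec k (p ^ s′) (λ u → sumVec k (p ^ s′) (λ v → 𝟙 (p * (p * Low.kernel u v) ≟ p ^ j))) ∎
      where open ≡-Reasoning


  -- The closed form

  withUnit-suc : ∀ k t → withUnit k (suc (suc t)) ≡ p ^ k * withUnit k (suc t)
  withUnit-suc k t = +-cancelʳ-≡ ((p ^ suc t) ^ k) (withUnit k (suc (suc t))) (p ^ k * withUnit k (suc t)) (begin
    withUnit k (suc (suc t)) + (p ^ suc t) ^ k          ≡⟨ Level.withUnit-+ (suc (suc t)) k (suc t) refl ⟩
    (p * p ^ suc t) ^ k                                 ≡⟨ ^-distribʳ-* p (p ^ suc t) k ⟩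
    p ^ k * (p ^ suc t) ^ k                             ≡⟨ cong (p ^ k *_) (sym (Level.withUnit-+ (suc t) k t refl)) ⟩
    p ^ k * (withUnit k (suc t) + (p ^ t) ^ k)          ≡⟨ *-distribˡ-+ (p ^ k) _ _ ⟩
    p ^ k * withUnit k (suc t) + p ^ k * (p ^ t) ^ k    ≡⟨ cong (p ^ k * withUnit k (suc t) +_) (sym (^-distribʳ-* p (p ^ t) k)) ⟩
    p ^ k * withUnit k (suc t) + (p ^ suc t) ^ k        ∎)
    where open ≡-Reasoning

  annihilatorCount-0≡withUnit : ∀ m j r → Level.annihilatorCount (j + suc r) 0 m j ≡ withUnit m (suc r)
  annihilatorCount-0≡withUnit m j r = +-cancelʳ-≡ ((p ^ r) ^ m) _ _
    (trans (Level.annihilatorCount-0 (j + suc r) m j r refl) (sym (Level.withUnit-+ (suc r) m r refl)))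

  divisiblePairsWithKernel-suc-suc : ∀ s′ n j →
    Level.divisiblePairsWithKernel (suc s′) n (suc (suc j)) ≡ Level.pairsWithKernel s′ n j
  divisiblePairsWithKernel-suc-suc s′ n j = trans (Scaling.divisiblePairsWithKernel-scale s′ n (suc (suc j)))
    (sumVec-cong n (p ^ s′) (λ u → sumVec-cong n (p ^ s′) (λ v → 𝟙-cong (_ ≟ _) (_ ≟ _) cancel-p² (cong (λ k → p * (p * k))))))
    where
    cancel-p² : ∀ {k} → p * (p * k) ≡ p ^ suc (suc j) → k ≡ p ^ j
    cancel-p² eq = *-cancelˡ-≡ _ _ p (*-cancelˡ-≡ _ _ p eq)

  divisiblePairsWithKernel-<2 : ∀ s′ n j → j < 2 → Level.divisiblePairsWithKernel (suc s′) n j ≡ 0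
  divisiblePairsWithKernel-<2 s′ n j j<2 = trans (Scaling.divisiblePairsWithKernel-scale s′ n j)
    (trans (sumVec-cong n (p ^ s′) (λ u → trans (sumVec-cong n (p ^ s′) (λ v → 𝟙-false (_ ≟ _) (p²*k≢p^j j j<2))) (sumVec-zero n (p ^ s′))))
           (sumVec-zero n (p ^ s′)))
    where
    p²*k≢p^j : ∀ j → j < 2 → ∀ {k} → ¬ p * (p * k) ≡ p ^ j
    p²*k≢p^j zero          _ {k} eq = <⇒≢ 1<p (sym (m*n≡1⇒m≡1 p (p * k) eq))
    p²*k≢p^j (suc zero)    _ {k} eq = <⇒≢ 1<p (sym (m*n≡1⇒m≡1 p k (*-cancelˡ-≡ _ _ p eq)))
    p²*k≢p^j (suc (suc j)) (s≤s (s≤s ()))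

  module ClosedForm (m : ℕ) where

    n : ℕ
    n = suc m

    pairsWithKernel-step : ∀ j r {A D} → Level.annihilatorCount (j + suc r) 1 m j ≡ A →
      Level.divisiblePairsWithKernel (j + suc r) n j ≡ D →
      Level.pairsWithKernel (j + suc r) n j
        ≡ withUnit n (j + suc r) * (p ^ (j + suc r) * withUnit m (suc r)) + withUnit n (j + suc r) * (p ^ (j + r) * A) + D
    pairsWithKernel-step j r A≡ D≡ =
      trans (Level.pairsWithKernel-decomposition (j + suc r) m j (j + r) (sym (+-suc j r)))
            (cong₂ _+_ (cong₂ _+_ (cong (λ a → withUnit n (j + suc r) * (p ^ (j + suc r) * a)) (annihilatorCount-0≡withUnit m j r))
                                  (cong (λ a → withUnit n (j + suc r) * (p ^ (j + r) * a)) A≡))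
                       D≡)

    closedForm : ∀ j r →
      Level.pairsWithKernel (j + suc r) n j ≡ withUnit n (j + suc r) * withUnit m (suc r) * p ^ suc r * gauss1 j p
    closedForm zero r = begin
      Level.pairsWithKernel (suc r) n 0
        ≡⟨ pairsWithKernel-step 0 r (Level.annihilatorCount-1-zero (suc r) m (s≤s z≤n)) (divisiblePairsWithKernel-<2 r n 0 (s≤s z≤n)) ⟩
      withUnit n (suc r) * (p ^ suc r * withUnit m (suc r)) + withUnit n (suc r) * (p ^ r * 0) + 0
        ≡⟨ ring (withUnit n (suc r)) (withUnit m (suc r)) (p ^ suc r) (p ^ r) ⟩
      withUnit n (suc r) * withUnit m (suc r) * p ^ suc r * 1 ∎
      where
      open ≡-Reasoning
      ring : ∀ U B P P′ → U * (P * B) + U * (P′ * 0) + 0 ≡ U * B * P * 1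
      ring = solve-∀
    closedForm (suc zero) r = begin
      Level.pairsWithKernel (suc (suc r)) n 1
        ≡⟨ pairsWithKernel-step 1 r (trans (Level.annihilatorCount-1-suc (suc (suc r)) m 0 (s≤s (s≤s z≤n))) (annihilatorCount-0≡withUnit m 1 r))
                                   (divisiblePairsWithKernel-<2 (suc r) n 1 (s≤s (s≤s z≤n))) ⟩
      withUnit n (suc (suc r)) * (p * p ^ suc r * withUnit m (suc r)) + withUnit n (suc (suc r)) * (p ^ suc r * withUnit m (suc r)) + 0
        ≡⟨ ring (withUnit n (suc (suc r))) (withUnit m (suc r)) (p ^ suc r) p ⟩
      withUnit n (suc (suc r)) * withUnit m (suc r) * p ^ suc r * (1 + p * 1) ∎
      where
      open ≡-Reasoning
      ring : ∀ U B P p → U * (p * P * B) + U * (P * B) + 0 ≡ U * B * P * (1 + p * 1)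
      ring = solve-∀
    closedForm (suc (suc j)) r = begin
      Level.pairsWithKernel (suc t) n (suc (suc j))
        ≡⟨ pairsWithKernel-step (suc (suc j)) r (trans (Level.annihilatorCount-1-suc (suc t) m (suc j) ssj<s) (annihilatorCount-0≡withUnit m (suc (suc j)) r))
                                                divisible≡ ⟩
      withUnit n (suc t) * (p ^ suc t * B) + withUnit n (suc t) * (p * (p * p ^ (j + r)) * B) + V * withUnit m (suc (suc r)) * (p * (p * R)) * g
        ≡⟨ cong₂ (λ u w → u * (p ^ suc t * B) + u * (p * (p * p ^ (j + r)) * B) + V * w * (p * (p * R)) * g)
                 (withUnit-suc n (j + suc r)) (withUnit-suc m r) ⟩
      p ^ n * V * (p * (p * p ^ (j + suc r)) * B) + p ^ n * V * (p * (p * p ^ (j + r)) * B) + V * (p ^ m * B) * (p * (p * R)) * g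
        ≡⟨ cong₂ (λ a b → p ^ n * V * (p * (p * a) * B) + p ^ n * V * (p * (p * b) * B) + V * (p ^ m * B) * (p * (p * R)) * g)
                 (^-distribˡ-+-* p j (suc r)) (^-distribˡ-+-* p j r) ⟩
      p * p ^ m * V * (p * (p * (X * (p * R))) * B) + p * p ^ m * V * (p * (p * (X * R)) * B) + V * (p ^ m * B) * (p * (p * R)) * g
        ≡⟨ ring V (p ^ m) B X R g p ⟩
      p * p ^ m * V * B * (p * R) * (g + p * X + p * (p * X))
        ≡⟨ cong (λ u → u * B * (p * R) * (g + p * X + p * (p * X))) (sym (withUnit-suc n (j + suc r))) ⟩
      withUnit n (suc t) * B * p ^ suc r * gauss1 (suc (suc j)) p ∎
      where
      open ≡-Reasoning
      t V B X R g : ℕ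
      t = suc (j + suc r)
      V = withUnit n t
      B = withUnit m (suc r)
      X = p ^ j
      R = p ^ r
      g = gauss1 j p
      ssj<s : suc (suc j) < suc t
      ssj<s = s≤s (s≤s (m<m+n j (s≤s z≤n)))
      divisible≡ : Level.divisiblePairsWithKernel (suc t) n (suc (suc j)) ≡ V * withUnit m (suc (suc r)) * p ^ suc (suc r) * g
      divisible≡ = trans (divisiblePairsWithKernel-suc-suc t n j)
        (subst (λ t′ → Level.pairsWithKernel t′ n j ≡ withUnit n t′ * withUnit m (suc (suc r)) * p ^ suc (suc r) * g)
               (+-suc j (suc r)) (closedForm j (suc r)))
      ring : ∀ V M B X R g p →
        p * M * V * (p * (p * (X * (p * R))) * B) + p * M * V * (p * (p * (X * R)) * B) + V * (M * B) * (p * (p * R)) * g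
          ≡ p * M * V * B * (p * R) * (g + p * X + p * (p * X))
      ring = solve-∀

  -- Back to E and φ

  module _ (s : ℕ) where
    open Level s

    IsSolution⇒Solves : ∀ {n} (A : Matrix n 2 q) x → IsSolution A x →
      Solves (column₀ A) (column₁ A) (toℕ (x Fin.zero)) (toℕ (x (Fin.suc Fin.zero)))
    IsSolution⇒Solves {zero}  A x h = tt
    IsSolution⇒Solves {suc n} A x h =
      subst (q ∣_) (cong (toℕ (A Fin.zero Fin.zero) * toℕ (x Fin.zero) +_) (+-identityʳ _)) (h Fin.zero) ,
      IsSolution⇒Solves (A ∘ Fin.suc) x (h ∘ Fin.suc)

    Solves⇒IsSolution : ∀ {n} (A : Matrix n 2 q) x →
      Solves (column₀ A) (column₁ A) (toℕ (x Fin.zero)) (toℕ (x (Fin.suc Fin.zero))) → IsSolution A x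
    Solves⇒IsSolution {suc n} A x (h , r) Fin.zero    =
      subst (q ∣_) (cong (toℕ (A Fin.zero Fin.zero) * toℕ (x Fin.zero) +_) (sym (+-identityʳ _))) h
    Solves⇒IsSolution {suc n} A x (h , r) (Fin.suc i) = Solves⇒IsSolution (A ∘ Fin.suc) x r i

    numSolutions≡kernel : ∀ {n} (A : Matrix n 2 q) → numSolutions A ≡ kernel (column₀ A) (column₁ A)
    numSolutions≡kernel A = begin
      numSolutions A
        ≡⟨ length-filter (isSolution? A) (tuples 2 (allFin q)) ⟩
      sumList (tuples 2 (allFin q)) (𝟙 ∘ isSolution? A)
        ≡⟨ sumList-cong (tuples 2 (allFin q)) (λ x → 𝟙-cong (isSolution? A x) (solves? (column₀ A) (column₁ A) (toℕ (x Fin.zero)) (toℕ (x (Fin.suc Fin.zero))))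
                                                    (IsSolution⇒Solves A x) (Solves⇒IsSolution A x)) ⟩
      sumList (tuples 2 (allFin q)) (λ x → 𝟙 (solves? (column₀ A) (column₁ A) (toℕ (x Fin.zero)) (toℕ (x (Fin.suc Fin.zero)))))
        ≡⟨ sumList-tuples 2 q (λ w → 𝟙 (solves? (column₀ A) (column₁ A) (Vec.head w) (Vec.head (Vec.tail w)))) ⟩
      kernel (column₀ A) (column₁ A) ∎
      where open ≡-Reasoning

    E≡pairsWithKernel : ∀ n j → E n 2 q (p ^ j) ≡ pairsWithKernel n j
    E≡pairsWithKernel n j = begin
      E n 2 q (p ^ j)
        ≡⟨ length-filter (λ A → numSolutions A ≟ p ^ j) (tuples n (tuples 2 (allFin q))) ⟩
      sumList (tuples n (tuples 2 (allFin q))) (λ A → 𝟙 (numSolutions A ≟ p ^ j))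
        ≡⟨ sumList-cong (tuples n (tuples 2 (allFin q))) (λ A → cong (λ k → 𝟙 (k ≟ p ^ j)) (numSolutions≡kernel A)) ⟩
      sumList (tuples n (tuples 2 (allFin q))) (λ A → 𝟙 (kernel (column₀ A) (column₁ A) ≟ p ^ j))
        ≡⟨ sumList-matrices n q (λ u v → 𝟙 (kernel u v ≟ p ^ j)) ⟩
      pairsWithKernel n j ∎
      where open ≡-Reasoning

  module _ (t : ℕ) where
    open Level (suc t)
    open Congruence q

    -- φ stores an entry a ∈ [1, q] as a − 1 (see Defs); shifting back modulo q only
    -- exchanges q for 0, both divisible by p.
    shift unshift : ℕ → ℕ
    shift   x = suc x % q
    unshift z = (z + Q) % q

    x+Q+1≈x : ∀ x → x + Q + 1 ≈ x
    x+Q+1≈x x = begin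
      x + Q + 1    ≡⟨ trans (+-assoc x Q 1) (cong (x +_) (trans (+-comm Q 1) suc-Q)) ⟩
      x + q        ≈⟨ ≈-+ˡ x (∣⇒≈0 ∣-refl) ⟩
      x + 0        ≡⟨ +-identityʳ x ⟩
      x            ∎
      where open ≈-Reasoning

    unshift-shift : ∀ x → x < q → unshift (shift x) ≡ x
    unshift-shift x x<q = ≈⇒%≡ x<q (begin
      shift x + Q    ≈⟨ ≈-+ʳ Q (%-≈ (suc x)) ⟩
      suc x + Q      ≡⟨ cong (_+ Q) (+-comm 1 x) ⟩
      x + 1 + Q      ≡⟨ trans (+-assoc x 1 Q) (trans (cong (x +_) (+-comm 1 Q)) (sym (+-assoc x Q 1))) ⟩
      x + Q + 1      ≈⟨ x+Q+1≈x x ⟩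
      x              ∎)
      where open ≈-Reasoning

    shift-unshift : ∀ z → z < q → shift (unshift z) ≡ z
    shift-unshift z z<q = ≈⇒%≡ z<q (begin
      suc (unshift z)    ≡⟨ +-comm 1 (unshift z) ⟩
      unshift z + 1      ≈⟨ ≈-+ʳ 1 (%-≈ (z + Q)) ⟩
      z + Q + 1          ≈⟨ x+Q+1≈x z ⟩
      z                  ∎)
      where open ≈-Reasoning

    p∣q : p ∣ q
    p∣q = divides (p ^ t) (*-comm p (p ^ t))

    coprime⇒unit-shift : ∀ x → Coprime (suc x) q → Unit (shift x)
    coprime⇒unit-shift x coprime p∣shift = <⇒≢ 1<p (sym (coprime (∣n∣m%n⇒∣m p∣q p∣shift , p∣q)))

    unit-shift⇒coprime : ∀ x → Unit (shift x) → Coprime (suc x) q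
    unit-shift⇒coprime x unit = coprime-^ (∤⇒coprime p-prime (λ p∣x+1 → unit (%-presˡ-∣ p∣x+1 p∣q))) (suc t)

    φ≡withUnit : ∀ k → φ k q ≡ withUnit k (suc t)
    φ≡withUnit k = begin
      φ k q
        ≡⟨ length-filter _ (tuples k (allFin q)) ⟩
      sumList (tuples k (allFin q)) (λ a → 𝟙 (Finₚ.any? (λ i → coprime? (suc (toℕ (a i))) q)))
        ≡⟨ sumList-cong (tuples k (allFin q)) (λ a → 𝟙-cong (Finₚ.any? _) (any? coprime-suc? (toVec a))
             (λ (i , c) → Anyₚ.tabulate⁺ i c) Anyₚ.tabulate⁻) ⟩
      sumList (tuples k (allFin q)) (λ a → 𝟙 (any? coprime-suc? (toVec a)))
        ≡⟨ sumList-tuples k q (λ w → 𝟙 (any? coprime-suc? w)) ⟩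
      sumVec k q (λ w → 𝟙 (any? coprime-suc? w))
        ≡⟨ sumVec-cong k q (λ w → 𝟙-cong (any? coprime-suc? w) (any? unit? (Vec.map shift w))
             (Anyₚ.map⁺ ∘ Any.map (coprime⇒unit-shift _)) (Any.map (unit-shift⇒coprime _) ∘ Anyₚ.map⁻)) ⟩
      sumVec k q (λ w → 𝟙 (any? unit? (Vec.map shift w)))
        ≡⟨ sumVec-map-bijection k q shift unshift (λ _ _ → m%n<n _ q) (λ _ _ → m%n<n _ q) unshift-shift shift-unshift (𝟙 ∘ any? unit?) ⟩
      withUnit k (suc t) ∎
      where
      open ≡-Reasoning
      coprime-suc? : (x : ℕ) → Dec (Coprime (suc x) q)
      coprime-suc? x = coprime? (suc x) q

<⇒≡+suc : ∀ {j s} → j < s → ∃ λ r → s ≡ j + suc r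
<⇒≡+suc {j} j<s with r , j+1+r≡s ← m≤n⇒∃[o]m+o≡n j<s = r , trans (sym j+1+r≡s) (sym (+-suc j r))

proposition4p3 : (p n s j : ℕ) → Prime p → 2 ≤ n → 1 ≤ s → j < s →
    E n 2 (p ^ s) (p ^ j)
      ≡ φ n (p ^ s) * φ (n ∸ 1) (p ^ (s ∸ j)) * p ^ (s ∸ j) * gauss1 j p
proposition4p3 p (suc m) s j p-prime _ _ j<s with r , refl ← <⇒≡+suc j<s = begin
  E (suc m) 2 (p ^ (j + suc r)) (p ^ j)
    ≡⟨ E≡pairsWithKernel p-prime (j + suc r) (suc m) j ⟩
  Level.pairsWithKernel p-prime (j + suc r) (suc m) j
    ≡⟨ ClosedForm.closedForm p-prime m j r ⟩
  withUnit p-prime (suc m) (j + suc r) * withUnit p-prime m (suc r) * p ^ suc r * gauss1 j p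
    ≡⟨ cong₂ (λ a b → a * b * p ^ suc r * gauss1 j p) (sym φ≡withUnit-n) (sym (φ≡withUnit p-prime r m)) ⟩
  φ (suc m) (p ^ (j + suc r)) * φ m (p ^ suc r) * p ^ suc r * gauss1 j p
    ≡⟨ cong (λ t → φ (suc m) (p ^ (j + suc r)) * φ m (p ^ t) * p ^ t * gauss1 j p) (sym (m+n∸m≡n j (suc r))) ⟩
  φ (suc m) (p ^ (j + suc r)) * φ m (p ^ (j + suc r ∸ j)) * p ^ (j + suc r ∸ j) * gauss1 j p ∎
  where
  open ≡-Reasoning
  φ≡withUnit-n : φ (suc m) (p ^ (j + suc r)) ≡ withUnit p-prime (suc m) (j + suc r)
  φ≡withUnit-n = subst (λ t → φ (suc m) (p ^ t) ≡ withUnit p-prime (suc m) t) (sym (+-suc j r)) (φ≡withUnit p-prime (j + r) (suc m))
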